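{- Let $k$ be a positive integer and let $D$ be an oriented graph of order $n$ in which every vertex has in-degree exactly $2$, and suppose $D$ has an out-branching. If $D$ has no out-tree with $k$ leaves, then $n \le 2k^5$.
   Context: An oriented graph is a digraph with no directed 2-cycle (and no loops or parallel arcs). An out-tree of a digraph $D$ is a subdigraph $T$ that is an oriented tree with exactly one vertex of in-degree zero (the root); its leaves are its vertices of out-degree zero. An out-branching of $D$ is an out-tree $T$ with $V(T)=V(D)$. "An out-tree with $k$ leaves" means an out-tree having (at least) $k$ leaves. -}

module Defs where

open import Data.Nat using (ℕ; zero; suc; _+_; _≡ᵇ_)
open import Data.Bool using (Bool; true; false; _∧_; if_then_else_)
open import Data.Fin using (Fin)
open import Data.List using (List; map; allFin)
open import Data.Nat.ListAction using (sum)
open import Data.Product using (Σ; _×_)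
open import Relation.Binary.PropositionalEquality using (_≡_)

-- A digraph on vertex set Fin n, given by its arc relation:
-- there is an arc u → v iff  A u v ≡ true.  (A relation, so no parallel arcs.)
Digraph : ℕ → Set
Digraph n = Fin n → Fin n → Bool

count : ∀ {n} → (Fin n → Bool) → ℕ
count {n} p = sum (map (λ i → if p i then 1 else 0) (allFin n))

inDeg : ∀ {n} → Digraph n → Fin n → ℕ
inDeg A v = count (λ u → A u v)

outDeg : ∀ {n} → Digraph n → Fin n → ℕ
outDeg A u = count (λ v → A u v)

numArcs : ∀ {n} → Digraph n → ℕ
numArcs {n} A = sum (map (outDeg A) (allFin n))

Oriented : ∀ {n} → Digraph n → Set
Oriented A = (∀ u → A u u ≡ false) × (∀ u v → A u v ≡ true → A v u ≡ false)

record Subdigraph {n} (D : Digraph n) : Set where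
  field
    verts : Fin n → Bool
    arcs  : Digraph n
    arcs⊆ : ∀ u v → arcs u v ≡ true →
            (D u v ≡ true) × (verts u ≡ true) × (verts v ≡ true)
open Subdigraph public

data UWalk {n} (A : Digraph n) : Fin n → Fin n → Set where
  here : ∀ {u} → UWalk A u u
  fwd  : ∀ {u v w} → A u v ≡ true → UWalk A v w → UWalk A u w
  bwd  : ∀ {u v w} → A v u ≡ true → UWalk A v w → UWalk A u w

IsTree : ∀ {n} {D : Digraph n} → Subdigraph D → Set
IsTree T =
  (∀ u v → verts T u ≡ true → verts T v ≡ true → UWalk (arcs T) u v)
  × (suc (numArcs (arcs T)) ≡ count (verts T))

IsOutTree : ∀ {n} {D : Digraph n} → Subdigraph D → Set
IsOutTree T =
  IsTree T × (count (λ v → verts T v ∧ (inDeg (arcs T) v ≡ᵇ 0)) ≡ 1)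

leaves : ∀ {n} {D : Digraph n} → Subdigraph D → ℕ
leaves T = count (λ v → verts T v ∧ (outDeg (arcs T) v ≡ᵇ 0))

IsOutBranching : ∀ {n} {D : Digraph n} → Subdigraph D → Set
IsOutBranching T = IsOutTree T × (∀ v → verts T v ≡ true)

{-# OPTIONS --safe #-}
module Submission where

-- Every bound comes from one construction: if each non-root vertex x of a set S picks an in-neighbour in S
-- so that some rank decreases, the picked arcs form an out-tree in which every vertex of S picked by nobody
-- is a leaf, so fewer than k vertices of S are picked by nobody.
--
-- Let v₀, …, v_h be a longest root path (the spine) of the out-branching B. Cutting B below a level makes
-- that level a set of leaves, so n < (h + 1) k; similarly fewer than k − 1 spine vertices have a child off
-- the spine. Each vᵢ (i ≥ 1) has one in-neighbour uᵢ besides vᵢ₋₁; let βᵢ be the spine index where the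
-- branch of uᵢ attaches. As D is oriented, βᵢ < i, or βᵢ ≥ i + 2, or a spine vertex at βᵢ ∈ {i, i + 1}
-- has a side child. Rehanging forward vᵢ on uᵢ, in two colour classes, leaves fewer than 2k − 3 forward
-- positions. Along a run of backward positions, rehanging vᵢ on uᵢ or on vᵢ₋₁ makes the positions sending
-- no chord, and (in four classes) those sending exactly one, into leaves; double counting the chords
-- bounds every run by 6k − 5. Splitting the spine into runs and the O(k) other positions gives h = O(k²).

open import Defs
open import Data.Bool using (Bool; true; false; _∧_; _∨_; not; if_then_else_)
import Data.Bool.Properties as Bool
open import Data.Bool.Properties using (∧-conicalˡ; ∧-conicalʳ; ∧-identityʳ; ∧-zeroʳ; ∨-zeroʳ; ∨-identityʳ; not-injective; not-¬)
open import Data.Empty using (⊥; ⊥-elim)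
open import Data.Fin using (Fin; zero; suc; toℕ; fromℕ<; inject₁; fromℕ)
import Data.Fin.Properties as Fin
open import Data.Fin.Properties using (any?; toℕ<n; toℕ-injective; toℕ-fromℕ<; toℕ-inject₁; toℕ-fromℕ) renaming (_≟_ to _≟ᶠ_)
open import Data.List using (map; allFin; tabulate)
open import Data.List.Extrema.Nat using (argmax; f[xs]≤f[argmax])
open import Data.List.Membership.Propositional.Properties using (∈-allFin)
open import Data.List.Properties using (map-tabulate)
open import Data.List.Relation.Unary.All as All using ()
import Data.Nat.ListAction as List
open import Data.Nat using (ℕ; zero; suc; _+_; _*_; _^_; _∸_; _≤_; _<_; _≤?_; _<?_; _≟_; _≡ᵇ_; z≤n; s≤s; s≤s⁻¹)
open import Data.Nat.GeneralisedArithmetic using (fold)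
open import Data.Nat.Properties
open import Algebra.Properties.CommutativeMonoid.Sum +-0-commutativeMonoid using (sum; ∑-comm; ∑-distrib-+; sum-cong-≗; sum-init-last)
open import Data.Nat.Solver using (module +-*-Solver)
open import Data.Product using (Σ; ∃; _×_; _,_; proj₁; proj₂)
open import Data.Sum using (_⊎_; inj₁; inj₂)
open import Relation.Binary.Definitions using (tri<; tri≈; tri>)
open import Relation.Binary.PropositionalEquality
open import Relation.Nullary using (¬_; Dec; yes; no; does)
open import Relation.Nullary.Decidable using (dec-true; dec-false)

private variable
  n : ℕ

dec-true⁻¹ : ∀ {a} {A : Set a} (a? : Dec A) → does a? ≡ true → A
dec-true⁻¹ (yes a) _ = a

dec-false⁻¹ : ∀ {a} {A : Set a} (a? : Dec A) → does a? ≡ false → ¬ A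
dec-false⁻¹ (no ¬a) _ = ¬a

∧-intro : ∀ {a b} → a ≡ true → b ≡ true → a ∧ b ≡ true
∧-intro refl refl = refl

∧-true⇒ : ∀ a {b} → a ∧ b ≡ true → a ≡ true × b ≡ true
∧-true⇒ true b≡true = refl , b≡true

∨-false⇒ : ∀ a {b} → a ∨ b ≡ false → a ≡ false × b ≡ false
∨-false⇒ false b≡false = refl , b≡false

χ : Bool → ℕ
χ b = if b then 1 else 0

χ-mono : ∀ {a b} → (a ≡ true → b ≡ true) → χ a ≤ χ b
χ-mono {false} _ = z≤n
χ-mono {true} a⇒b rewrite a⇒b refl = ≤-refl

sum-map-allFin : (f : Fin n → ℕ) → List.sum (map f (allFin n)) ≡ sum f
sum-map-allFin {n} f = trans (cong List.sum (map-tabulate (λ i → i) f)) (go f)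
  where
  go : ∀ {m} (g : Fin m → ℕ) → List.sum (tabulate g) ≡ sum g
  go {zero} g = refl
  go {suc m} g = cong (g zero +_) (go (λ i → g (suc i)))

∑-mono-≤ : {f g : Fin n → ℕ} → (∀ i → f i ≤ g i) → sum f ≤ sum g
∑-mono-≤ {zero} f≤g = z≤n
∑-mono-≤ {suc n} f≤g = +-mono-≤ (f≤g zero) (∑-mono-≤ (λ i → f≤g (suc i)))

∑-tight : (f g : Fin n → ℕ) → (∀ i → f i ≤ g i) → sum g ≤ sum f → ∀ i → f i ≡ g i
∑-tight {suc n} f g f≤g ∑g≤∑f zero =
  ≤-antisym (f≤g zero) (+-cancelʳ-≤ _ _ _ (≤-trans ∑g≤∑f (+-monoʳ-≤ (f zero) (∑-mono-≤ (λ i → f≤g (suc i))))))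
∑-tight {suc n} f g f≤g ∑g≤∑f (suc i) =
  ∑-tight (λ i → f (suc i)) (λ i → g (suc i)) (λ i → f≤g (suc i))
    (+-cancelˡ-≤ (g zero) _ _ (≤-trans ∑g≤∑f (+-monoˡ-≤ _ (f≤g zero)))) i

count≡∑χ : (p : Fin n → Bool) → count p ≡ sum (λ i → χ (p i))
count≡∑χ p = sum-map-allFin (λ i → χ (p i))

count-cong : {p q : Fin n → Bool} → (∀ i → p i ≡ q i) → count p ≡ count q
count-cong {p = p} {q} p≗q = begin
  count p            ≡⟨ count≡∑χ p ⟩
  sum (λ i → χ (p i)) ≡⟨ sum-cong-≗ (λ i → cong χ (p≗q i)) ⟩
  sum (λ i → χ (q i)) ≡⟨ count≡∑χ q ⟨
  count q            ∎
  where open ≡-Reasoning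

count-mono : {p q : Fin n → Bool} → (∀ i → p i ≡ true → q i ≡ true) → count p ≤ count q
count-mono {p = p} {q} p⇒q = begin
  count p               ≡⟨ count≡∑χ p ⟩
  sum (λ i → χ (p i))   ≤⟨ ∑-mono-≤ (λ i → χ-mono (p⇒q i)) ⟩
  sum (λ i → χ (q i))   ≡⟨ count≡∑χ q ⟨
  count q               ∎
  where open ≤-Reasoning

count-true : count {n} (λ _ → true) ≡ n
count-true {n} = trans (count≡∑χ {n} (λ _ → true)) (go n)
  where
  go : ∀ m → sum {m} (λ _ → 1) ≡ m
  go zero = refl
  go (suc m) = cong suc (go m)

count-false : {p : Fin n → Bool} → (∀ i → p i ≡ false) → count p ≡ 0
count-false {n} {p} p≗false = trans (count-cong p≗false) (trans (count≡∑χ {n} (λ _ → false)) (go n))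
  where
  go : ∀ m → sum {m} (λ _ → 0) ≡ 0
  go zero = refl
  go (suc m) = go m

count-suc : (p : Fin (suc n) → Bool) → count p ≡ χ (p zero) + count (λ i → p (suc i))
count-suc p = trans (count≡∑χ p) (cong (χ (p zero) +_) (sym (count≡∑χ (λ i → p (suc i)))))

count-split : (p q : Fin n → Bool) →
  count p ≡ count (λ i → p i ∧ q i) + count (λ i → p i ∧ not (q i))
count-split p q = begin
  count p                                                        ≡⟨ count≡∑χ p ⟩
  sum (λ i → χ (p i))                                            ≡⟨ sum-cong-≗ (λ i → χ-split (p i) (q i)) ⟩
  sum (λ i → χ (p i ∧ q i) + χ (p i ∧ not (q i)))                ≡⟨ ∑-distrib-+ (λ i → χ (p i ∧ q i)) (λ i → χ (p i ∧ not (q i))) ⟩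
  sum (λ i → χ (p i ∧ q i)) + sum (λ i → χ (p i ∧ not (q i)))    ≡⟨ cong₂ _+_ (count≡∑χ (λ i → p i ∧ q i)) (count≡∑χ (λ i → p i ∧ not (q i))) ⟨
  count (λ i → p i ∧ q i) + count (λ i → p i ∧ not (q i))        ∎
  where
  open ≡-Reasoning
  χ-split : ∀ a b → χ a ≡ χ (a ∧ b) + χ (a ∧ not b)
  χ-split false _ = refl
  χ-split true false = refl
  χ-split true true = refl

count-∨ : (p q : Fin n → Bool) → count (λ i → p i ∨ q i) ≤ count p + count q
count-∨ p q = begin
  count (λ i → p i ∨ q i)                  ≡⟨ count≡∑χ (λ i → p i ∨ q i) ⟩
  sum (λ i → χ (p i ∨ q i))                ≤⟨ ∑-mono-≤ (λ i → χ-∨ (p i) (q i)) ⟩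
  sum (λ i → χ (p i) + χ (q i))            ≡⟨ ∑-distrib-+ (λ i → χ (p i)) (λ i → χ (q i)) ⟩
  sum (λ i → χ (p i)) + sum (λ i → χ (q i)) ≡⟨ cong₂ _+_ (count≡∑χ p) (count≡∑χ q) ⟨
  count p + count q                        ∎
  where
  open ≤-Reasoning
  χ-∨ : ∀ a b → χ (a ∨ b) ≤ χ a + χ b
  χ-∨ true _ = s≤s z≤n
  χ-∨ false _ = ≤-refl

count-at : (p : Fin n → Bool) (a : Fin n) → count (λ i → p i ∧ does (i ≟ᶠ a)) ≡ χ (p a)
count-at p a = trans (count≡∑χ (λ i → p i ∧ does (i ≟ᶠ a))) (go p a)
  where
  go : ∀ {m} (p : Fin m → Bool) (a : Fin m) → sum (λ i → χ (p i ∧ does (i ≟ᶠ a))) ≡ χ (p a)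
  go {suc m} p zero = begin
    χ (p zero ∧ true) + sum (λ i → χ (p (suc i) ∧ false))   ≡⟨ cong₂ _+_ (cong χ (∧-identityʳ (p zero))) (sum-cong-≗ (λ i → cong χ (∧-zeroʳ (p (suc i))))) ⟩
    χ (p zero) + sum {m} (λ _ → 0)                          ≡⟨ cong (χ (p zero) +_) (trans (sym (count≡∑χ {m} (λ _ → false))) (count-false {m} {λ _ → false} (λ _ → refl))) ⟩
    χ (p zero) + 0                                          ≡⟨ +-identityʳ _ ⟩
    χ (p zero)                                              ∎
    where open ≡-Reasoning
  go {suc m} p (suc a) = begin
    χ (p zero ∧ false) + sum (λ i → χ (p (suc i) ∧ does (i ≟ᶠ a)))   ≡⟨ cong (_+ sum (λ i → χ (p (suc i) ∧ does (i ≟ᶠ a)))) (cong χ (∧-zeroʳ (p zero))) ⟩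
    sum (λ i → χ (p (suc i) ∧ does (i ≟ᶠ a)))                        ≡⟨ go (λ i → p (suc i)) a ⟩
    χ (p (suc a))                                                    ∎
    where open ≡-Reasoning

count-remove : (p : Fin n → Bool) (a : Fin n) →
  count p ≡ χ (p a) + count (λ i → p i ∧ not (does (i ≟ᶠ a)))
count-remove p a = trans (count-split p (λ i → does (i ≟ᶠ a))) (cong (_+ count (λ i → p i ∧ not (does (i ≟ᶠ a)))) (count-at p a))

true⇒count>0 : (p : Fin n → Bool) {a : Fin n} → p a ≡ true → 0 < count p
true⇒count>0 p {a} pa = ≤-trans (≤-reflexive (cong χ (sym pa))) (≤-trans (m≤m+n (χ (p a)) _) (≤-reflexive (sym (count-remove p a))))

count≡0⇒false : (p : Fin n → Bool) → count p ≡ 0 → ∀ i → p i ≡ false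
count≡0⇒false p #p≡0 i with p i in pi
... | false = refl
... | true = ⊥-elim (<-irrefl (sym #p≡0) (true⇒count>0 p pi))

count>0⇒∃ : (p : Fin n → Bool) → 0 < count p → ∃ λ i → p i ≡ true
count>0⇒∃ p #p>0 with any? (λ i → p i Bool.≟ true)
... | yes witness = witness
... | no none = ⊥-elim (<-irrefl (sym (count-false λ i → ¬-not-true (λ pi → none (i , pi)))) #p>0)
  where
  ¬-not-true : ∀ {b} → ¬ (b ≡ true) → b ≡ false
  ¬-not-true {false} _ = refl
  ¬-not-true {true} b≢true = ⊥-elim (b≢true refl)

count≡1⇒unique : (p : Fin n → Bool) → count p ≡ 1 → ∀ {i j} → p i ≡ true → p j ≡ true → i ≡ j
count≡1⇒unique p #p≡1 {i} {j} pi pj with j ≟ᶠ i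
... | yes j≡i = sym j≡i
... | no j≢i = ⊥-elim (not-¬ (count≡0⇒false _ rest≡0 j) (∧-intro pj (cong not (dec-false (j ≟ᶠ i) j≢i))))
  where
  rest≡0 : count (λ x → p x ∧ not (does (x ≟ᶠ i))) ≡ 0
  rest≡0 = suc-injective (trans (cong (_+ count (λ x → p x ∧ not (does (x ≟ᶠ i)))) (cong χ (sym pi))) (trans (sym (count-remove p i)) #p≡1))

count-injection : ∀ {m} (p : Fin m → Bool) (q : Fin n → Bool) (g : Fin m → Fin n) →
  (∀ i → p i ≡ true → q (g i) ≡ true) →
  (∀ i j → p i ≡ true → p j ≡ true → g i ≡ g j → i ≡ j) →
  count p ≤ count q
count-injection {m = zero} p q g _ _ = z≤n
count-injection {m = suc m} p q g p⇒q g-inj = begin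
  count p                                ≡⟨ count-suc p ⟩
  χ (p zero) + count (λ i → p (suc i))   ≤⟨ step (p zero) refl ⟩
  count q                                ∎
  where
  open ≤-Reasoning
  tail-inj : ∀ {q′ : Fin _ → Bool} → (∀ i → p (suc i) ≡ true → q′ (g (suc i)) ≡ true) →
    count (λ i → p (suc i)) ≤ count q′
  tail-inj {q′} p⇒q′ = count-injection _ q′ (λ i → g (suc i)) p⇒q′
    (λ i j pi pj e → Fin.suc-injective (g-inj (suc i) (suc j) pi pj e))
  q-g0 : Fin _ → Bool
  q-g0 x = q x ∧ not (does (x ≟ᶠ g zero))
  step : ∀ b → p zero ≡ b → χ b + count (λ i → p (suc i)) ≤ count q
  step false _ = tail-inj (λ i → p⇒q (suc i))
  step true p0 = begin
    suc (count (λ i → p (suc i)))   ≤⟨ s≤s (tail-inj avoids-g0) ⟩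
    suc (count q-g0)                ≡⟨ cong (λ b → χ b + count q-g0) (p⇒q zero p0) ⟨
    χ (q (g zero)) + count q-g0     ≡⟨ count-remove q (g zero) ⟨
    count q                         ∎
    where
    avoids-g0 : ∀ i → p (suc i) ≡ true → q-g0 (g (suc i)) ≡ true
    avoids-g0 i pi = ∧-intro (p⇒q (suc i) pi)
      (cong not (dec-false (g (suc i) ≟ᶠ g zero) (λ e → Fin.0≢1+n (sym (g-inj (suc i) zero pi p0 e)))))

choose : (Fin n → Bool) → Fin n → Fin n
choose p default with any? (λ i → p i Bool.≟ true)
... | yes (i , _) = i
... | no _ = default

choose-true : (p : Fin n → Bool) (default : Fin n) {x : Fin n} → p x ≡ true → p (choose p default) ≡ true
choose-true p default {x} px with any? (λ i → p i Bool.≟ true)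
... | yes (_ , pi) = pi
... | no none = ⊥-elim (none (x , px))

numArcs≡∑inDeg : (A : Digraph n) → numArcs A ≡ sum (inDeg A)
numArcs≡∑inDeg {n} A = begin
  numArcs A                                       ≡⟨ sum-map-allFin (outDeg A) ⟩
  sum (outDeg A)                                  ≡⟨ sum-cong-≗ (λ u → count≡∑χ (A u)) ⟩
  sum (λ u → sum (λ v → χ (A u v)))               ≡⟨ ∑-comm (λ u v → χ (A u v)) ⟩
  sum (λ v → sum (λ u → χ (A u v)))               ≡⟨ sum-cong-≗ (λ v → count≡∑χ (λ u → A u v)) ⟨
  sum (inDeg A)                                   ∎
  where open ≡-Reasoning

countBelow : ℕ → (ℕ → Bool) → ℕ
countBelow m P = count {m} (λ i → P (toℕ i))

module _ {m : ℕ} {P : ℕ → Bool} where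

  countBelow-cong : {Q : ℕ → Bool} → (∀ y → y < m → P y ≡ Q y) → countBelow m P ≡ countBelow m Q
  countBelow-cong P≗Q = count-cong (λ i → P≗Q (toℕ i) (toℕ<n i))

  countBelow-mono : {Q : ℕ → Bool} → (∀ y → y < m → P y ≡ true → Q y ≡ true) → countBelow m P ≤ countBelow m Q
  countBelow-mono P⇒Q = count-mono (λ i → P⇒Q (toℕ i) (toℕ<n i))

  countBelow≡0⇒false : countBelow m P ≡ 0 → ∀ {y} → y < m → P y ≡ false
  countBelow≡0⇒false #P≡0 y<m =
    subst (λ z → P z ≡ false) (toℕ-fromℕ< y<m) (count≡0⇒false (λ i → P (toℕ i)) #P≡0 (fromℕ< y<m))

  countBelow>0⇒∃ : 0 < countBelow m P → ∃ λ y → y < m × P y ≡ true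
  countBelow>0⇒∃ #P>0 with count>0⇒∃ (λ i → P (toℕ i)) #P>0
  ... | i , Pi = toℕ i , toℕ<n i , Pi

  countBelow≡1⇒unique : countBelow m P ≡ 1 → ∀ {y z} → y < m → z < m → P y ≡ true → P z ≡ true → y ≡ z
  countBelow≡1⇒unique #P≡1 {y} {z} y<m z<m Py Pz = begin
    y                     ≡⟨ toℕ-fromℕ< y<m ⟨
    toℕ (fromℕ< y<m)      ≡⟨ cong toℕ (count≡1⇒unique (λ i → P (toℕ i)) #P≡1 (at y<m Py) (at z<m Pz)) ⟩
    toℕ (fromℕ< z<m)      ≡⟨ toℕ-fromℕ< z<m ⟩
    z                     ∎
    where
    open ≡-Reasoning
    at : ∀ {x} (x<m : x < m) → P x ≡ true → P (toℕ (fromℕ< x<m)) ≡ true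
    at x<m Px = trans (cong P (toℕ-fromℕ< x<m)) Px

  countBelow-injection : ∀ {n} (Q : Fin n → Bool) (g : ℕ → Fin n) →
    (∀ y → y < m → P y ≡ true → Q (g y) ≡ true) →
    (∀ y z → y < m → z < m → P y ≡ true → P z ≡ true → g y ≡ g z → y ≡ z) →
    countBelow m P ≤ count Q
  countBelow-injection Q g P⇒Q g-inj = count-injection _ Q (λ i → g (toℕ i))
    (λ i → P⇒Q (toℕ i) (toℕ<n i))
    (λ i j Pi Pj e → toℕ-injective (g-inj (toℕ i) (toℕ j) (toℕ<n i) (toℕ<n j) Pi Pj e))

countBelow-≤1 : ∀ m (P : ℕ → Bool) → (∀ y z → y < m → z < m → P y ≡ true → P z ≡ true → y ≡ z) → countBelow m P ≤ 1
countBelow-≤1 m P unique = countBelow-injection {m} {P} (λ (_ : Fin 1) → true) (λ _ → zero) (λ _ _ _ → refl)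
  (λ y z y<m z<m Py Pz _ → unique y z y<m z<m Py Pz)

countBelow-∨ : ∀ m (P Q : ℕ → Bool) → countBelow m (λ y → P y ∨ Q y) ≤ countBelow m P + countBelow m Q
countBelow-∨ m P Q = count-∨ {m} (λ i → P (toℕ i)) (λ i → Q (toℕ i))

countBelow-suc : ∀ m (P : ℕ → Bool) → countBelow (suc m) P ≡ countBelow m P + χ (P m)
countBelow-suc m P = begin
  countBelow (suc m) P                                     ≡⟨ count≡∑χ {suc m} (λ i → P (toℕ i)) ⟩
  sum {suc m} (λ i → χ (P (toℕ i)))                        ≡⟨ sum-init-last {m} (λ i → χ (P (toℕ i))) ⟩
  sum {m} (λ i → χ (P (toℕ (inject₁ i)))) + χ (P (toℕ (fromℕ m)))
    ≡⟨ cong₂ _+_ (sum-cong-≗ {m} (λ i → cong (λ z → χ (P z)) (toℕ-inject₁ i))) (cong (λ z → χ (P z)) (toℕ-fromℕ m)) ⟩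
  sum {m} (λ i → χ (P (toℕ i))) + χ (P m)                  ≡⟨ cong (_+ χ (P m)) (count≡∑χ {m} (λ i → P (toℕ i))) ⟨
  countBelow m P + χ (P m)                                 ∎
  where open ≡-Reasoning

countBelow-shift : ∀ m (P : ℕ → Bool) → countBelow (suc m) P ≡ χ (P 0) + countBelow m (λ y → P (suc y))
countBelow-shift m P = count-suc {m} (λ i → P (toℕ i))

countBelow-shift≤ : ∀ m (P : ℕ → Bool) → countBelow m (λ y → P (suc y)) ≤ countBelow (suc m) P
countBelow-shift≤ m P = ≤-trans (m≤n+m _ (χ (P 0))) (≤-reflexive (sym (countBelow-shift m P)))

countBelow-∨-last : ∀ m (P : ℕ → Bool) → countBelow (suc m) (λ y → P y ∨ does (y ≟ m)) ≡ suc (countBelow m P)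
countBelow-∨-last m P = begin
  countBelow (suc m) P∨m                 ≡⟨ countBelow-suc m P∨m ⟩
  countBelow m P∨m + χ (P m ∨ does (m ≟ m)) ≡⟨ cong₂ _+_ (countBelow-cong below-m) (cong (λ b → χ (P m ∨ b)) (dec-true (m ≟ m) refl)) ⟩
  countBelow m P + χ (P m ∨ true)        ≡⟨ cong (λ b → countBelow m P + χ b) (∨-zeroʳ (P m)) ⟩
  countBelow m P + 1                     ≡⟨ +-comm _ 1 ⟩
  suc (countBelow m P)                   ∎
  where
  open ≡-Reasoning
  P∨m : ℕ → Bool
  P∨m y = P y ∨ does (y ≟ m)
  below-m : ∀ y → y < m → P∨m y ≡ P y
  below-m y y<m = trans (cong (P y ∨_) (dec-false (y ≟ m) (<⇒≢ y<m))) (∨-identityʳ (P y))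

countBelow-false-beyond : ∀ m t (P : ℕ → Bool) → (∀ y → m ≤ y → P y ≡ false) → countBelow (t + m) P ≡ countBelow m P
countBelow-false-beyond m zero P _ = refl
countBelow-false-beyond m (suc t) P beyond = begin
  countBelow (suc (t + m)) P              ≡⟨ countBelow-suc (t + m) P ⟩
  countBelow (t + m) P + χ (P (t + m))    ≡⟨ cong₂ _+_ (countBelow-false-beyond m t P beyond) (cong χ (beyond (t + m) (m≤n+m m t))) ⟩
  countBelow m P + 0                      ≡⟨ +-identityʳ _ ⟩
  countBelow m P                          ∎
  where open ≡-Reasoning

countBelow-≥ : ∀ L t → countBelow (L + t) (λ y → does (L ≤? y)) ≡ t
countBelow-≥ L zero = trans (cong (λ m → countBelow m (λ y → does (L ≤? y))) (+-identityʳ L))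
  (count-false {L} (λ i → dec-false (L ≤? toℕ i) (<⇒≱ (toℕ<n i))))
countBelow-≥ L (suc t) = begin
  countBelow (L + suc t) L≤                      ≡⟨ cong (λ m → countBelow m L≤) (+-suc L t) ⟩
  countBelow (suc (L + t)) L≤                    ≡⟨ countBelow-suc (L + t) L≤ ⟩
  countBelow (L + t) L≤ + χ (does (L ≤? L + t))  ≡⟨ cong₂ _+_ (countBelow-≥ L t) (cong χ (dec-true (L ≤? L + t) (m≤m+n L t))) ⟩
  t + 1                                          ≡⟨ +-comm t 1 ⟩
  suc t                                          ∎
  where
  open ≡-Reasoning
  L≤ : ℕ → Bool
  L≤ y = does (L ≤? y)

chooseBelow : ℕ → (ℕ → Bool) → ℕ
chooseBelow m P with anyUpTo? (λ y → P y Bool.≟ true) m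
... | yes (y , _ , _) = y
... | no _ = 0

chooseBelow-spec : ∀ m (P : ℕ → Bool) {y} → y < m → P y ≡ true →
  chooseBelow m P < m × P (chooseBelow m P) ≡ true
chooseBelow-spec m P {y} y<m Py with anyUpTo? (λ y → P y Bool.≟ true) m
... | yes (_ , z<m , Pz) = z<m , Pz
... | no none = ⊥-elim (none (y , y<m , Py))

module Alternation (active : ℕ → Bool) (next : ℕ → ℕ) (next< : ∀ {y} → active y ≡ true → next y < y) where

  private
    colourWithin : ℕ → ℕ → Bool
    colourWithin zero y = false
    colourWithin (suc fuel) y = if active y then not (colourWithin fuel (next y)) else false

    colourWithin-stable : ∀ f g y → y < f → y < g → colourWithin f y ≡ colourWithin g y
    colourWithin-stable (suc f) (suc g) y y<f y<g with active y in act
    ... | false = refl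
    ... | true = cong not (colourWithin-stable f g (next y)
      (≤-trans (next< act) (s≤s⁻¹ y<f)) (≤-trans (next< act) (s≤s⁻¹ y<g)))

  opaque
    -- next decreases along active positions, so fuel suc y always suffices.
    colour : ℕ → Bool
    colour y = colourWithin (suc y) y

    colour-next : ∀ {y} → active y ≡ true → colour y ≡ not (colour (next y))
    colour-next {y} act = trans
      (cong (λ b → if b then not (colourWithin y (next y)) else false) act)
      (cong not (colourWithin-stable y (suc (next y)) (next y) (next< act) ≤-refl))

parity : ℕ → Bool
parity zero = true
parity (suc m) = not (parity m)

lex-<ˡ : ∀ M {a a′ b b′} → a < a′ → b < M → a * M + b < a′ * M + b′
lex-<ˡ M {a} {a′} {b} {b′} a<a′ b<M = begin-strict
  a * M + b       <⟨ +-monoʳ-< (a * M) b<M ⟩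
  a * M + M       ≡⟨ +-comm (a * M) M ⟩
  suc a * M       ≤⟨ *-monoˡ-≤ M a<a′ ⟩
  a′ * M          ≤⟨ m≤m+n (a′ * M) b′ ⟩
  a′ * M + b′     ∎
  where open ≤-Reasoning

lex-<ʳ : ∀ M {a a′ b b′} → a ≤ a′ → b < b′ → a * M + b < a′ * M + b′
lex-<ʳ M a≤a′ b<b′ = +-mono-≤-< (*-monoˡ-≤ M a≤a′) b<b′

potential-drop-chord : ∀ a i b → suc (suc i) ≤ b → b < a → 3 * (a ∸ b) + 4 < 3 * (a ∸ i)
potential-drop-chord a i b i+2≤b b<a = begin-strict
  3 * (a ∸ b) + 4         <⟨ +-monoʳ-< (3 * (a ∸ b)) (n≤1+n 5) ⟩
  3 * (a ∸ b) + 3 * 2     ≡⟨ *-distribˡ-+ 3 (a ∸ b) 2 ⟨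
  3 * (a ∸ b + 2)         ≤⟨ *-monoʳ-≤ 3 a-b+2≤a-i ⟩
  3 * (a ∸ i)             ∎
  where
  open ≤-Reasoning
  a-b+2≤a-i : a ∸ b + 2 ≤ a ∸ i
  a-b+2≤a-i = begin
    a ∸ b + 2                ≡⟨ +-comm (a ∸ b) 2 ⟩
    2 + (a ∸ b)              ≡⟨ +-∸-assoc 2 (<⇒≤ b<a) ⟨
    2 + a ∸ b                ≤⟨ ∸-monoʳ-≤ (2 + a) i+2≤b ⟩
    2 + a ∸ (2 + i)          ≡⟨ [m+n]∸[m+o]≡n∸o 2 a i ⟩
    a ∸ i                    ∎

potential-drop-step : ∀ a i → 0 < i → i ≤ a → 3 * (a ∸ (i ∸ 1)) < 3 * (a ∸ i) + 4
potential-drop-step a (suc i) _ 1+i≤a = begin-strict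
  3 * (a ∸ i)             ≡⟨ cong (3 *_) (+-∸-assoc 1 1+i≤a) ⟩
  3 * suc (a ∸ suc i)     ≡⟨ *-suc 3 (a ∸ suc i) ⟩
  3 + 3 * (a ∸ suc i)     <⟨ +-monoˡ-< (3 * (a ∸ suc i)) (n<1+n 3) ⟩
  4 + 3 * (a ∸ suc i)     ≡⟨ +-comm 4 _ ⟩
  3 * (a ∸ suc i) + 4     ∎
  where open ≤-Reasoning

NoOutTreeWithLeaves : Digraph n → ℕ → Set
NoOutTreeWithLeaves D k = ¬ (Σ (Subdigraph D) (λ T → IsOutTree T × k ≤ leaves T))

_++ʷ_ : {A : Digraph n} {u v w : Fin n} → UWalk A u v → UWalk A v w → UWalk A u w
here ++ʷ q = q
fwd a p ++ʷ q = fwd a (p ++ʷ q)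
bwd a p ++ʷ q = bwd a (p ++ʷ q)

reverseʷ : {A : Digraph n} {u v : Fin n} → UWalk A u v → UWalk A v u
reverseʷ here = here
reverseʷ (fwd a p) = reverseʷ p ++ʷ bwd a here
reverseʷ (bwd a p) = reverseʷ p ++ʷ fwd a here

record ParentMap (D : Digraph n) : Set where
  field
    member : Fin n → Bool
    root : Fin n
    parent : Fin n → Fin n
    rank : Fin n → ℕ
    root-member : member root ≡ true
    parent-member : ∀ {x} → member x ≡ true → x ≢ root → member (parent x) ≡ true
    parent-arc : ∀ {x} → member x ≡ true → x ≢ root → D (parent x) x ≡ true
    parent-rank : ∀ {x} → member x ≡ true → x ≢ root → rank (parent x) < rank x

module ParentMapTree {D : Digraph n} (P : ParentMap D) where

  open ParentMap P

  nonRoot : Fin n → Bool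
  nonRoot v = member v ∧ not (does (v ≟ᶠ root))

  treeArcs : Digraph n
  treeArcs u v = nonRoot v ∧ does (u ≟ᶠ parent v)

  treeArc⇒ : ∀ {u v} → treeArcs u v ≡ true → member v ≡ true × v ≢ root × u ≡ parent v
  treeArc⇒ {u} {v} uv =
      ∧-conicalˡ (member v) _ v-nonRoot
    , dec-false⁻¹ (v ≟ᶠ root) (not-injective (∧-conicalʳ (member v) _ v-nonRoot))
    , dec-true⁻¹ (u ≟ᶠ parent v) (∧-conicalʳ (nonRoot v) _ uv)
    where
    v-nonRoot : nonRoot v ≡ true
    v-nonRoot = ∧-conicalˡ (nonRoot v) _ uv

  treeArc : ∀ {v} → member v ≡ true → v ≢ root → treeArcs (parent v) v ≡ true
  treeArc {v} mv v≢root =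
    ∧-intro (∧-intro mv (cong not (dec-false (v ≟ᶠ root) v≢root))) (dec-true (parent v ≟ᶠ parent v) refl)

  tree : Subdigraph D
  tree = record
    { verts = member
    ; arcs = treeArcs
    ; arcs⊆ = λ u v uv → arcs⊆′ (treeArc⇒ uv)
    }
    where
    arcs⊆′ : ∀ {u v} → member v ≡ true × v ≢ root × u ≡ parent v →
      D u v ≡ true × member u ≡ true × member v ≡ true
    arcs⊆′ (mv , v≢root , refl) = parent-arc mv v≢root , parent-member mv v≢root , mv

  walkToRoot : ∀ x → member x ≡ true → UWalk treeArcs x root
  walkToRoot x mx = go (suc (rank x)) x ≤-refl mx
    where
    go : ∀ fuel x → rank x < fuel → member x ≡ true → UWalk treeArcs x root
    go (suc fuel) x rank<fuel mx with x ≟ᶠ root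
    ... | yes refl = here
    ... | no x≢root = bwd (treeArc mx x≢root)
      (go fuel (parent x) (≤-trans (parent-rank mx x≢root) (s≤s⁻¹ rank<fuel)) (parent-member mx x≢root))

  inDeg-treeArcs : ∀ v → inDeg treeArcs v ≡ χ (nonRoot v)
  inDeg-treeArcs v = count-at (λ _ → nonRoot v) (parent v)

  numArcs-tree : suc (numArcs treeArcs) ≡ count member
  numArcs-tree = begin
    suc (numArcs treeArcs)                        ≡⟨ cong suc (numArcs≡∑inDeg treeArcs) ⟩
    suc (sum (inDeg treeArcs))                    ≡⟨ cong suc (sum-cong-≗ inDeg-treeArcs) ⟩
    suc (sum (λ v → χ (nonRoot v)))               ≡⟨ cong suc (count≡∑χ nonRoot) ⟨
    χ true + count nonRoot                        ≡⟨ cong (λ b → χ b + count nonRoot) root-member ⟨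
    χ (member root) + count nonRoot               ≡⟨ count-remove member root ⟨
    count member                                  ∎
    where open ≡-Reasoning

  count-roots : count (λ v → member v ∧ (inDeg treeArcs v ≡ᵇ 0)) ≡ 1
  count-roots = trans (count-cong is-root) (count-at (λ _ → true) root)
    where
    is-root : ∀ v → (member v ∧ (inDeg treeArcs v ≡ᵇ 0)) ≡ does (v ≟ᶠ root)
    is-root v rewrite inDeg-treeArcs v with v ≟ᶠ root
    ... | yes refl rewrite root-member = refl
    ... | no _ with member v
    ...   | true = refl
    ...   | false = refl

  tree-isOutTree : IsOutTree tree
  tree-isOutTree =
    ((λ u v mu mv → walkToRoot u mu ++ʷ reverseʷ (walkToRoot v mv)) , numArcs-tree) , count-roots

  Childless : Fin n → Set
  Childless x = member x ≡ true × (∀ y → member y ≡ true → y ≢ root → parent y ≢ x)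

  childless⇒leaf : ∀ {x} → Childless x → (member x ∧ (outDeg treeArcs x ≡ᵇ 0)) ≡ true
  childless⇒leaf {x} (mx , no-child) =
    ∧-intro mx (cong (_≡ᵇ 0) (count-false (λ y → no-arc y)))
    where
    no-arc : ∀ y → treeArcs x y ≡ false
    no-arc y with treeArcs x y in xy
    ... | false = refl
    ... | true with treeArc⇒ xy
    ...   | my , y≢root , x≡py = ⊥-elim (no-child y my y≢root (sym x≡py))

  module _ {k : ℕ} (noK : NoOutTreeWithLeaves D k) where

    leaves<k : leaves tree < k
    leaves<k with k ≤? leaves tree
    ... | yes k≤leaves = ⊥-elim (noK (tree , tree-isOutTree , k≤leaves))
    ... | no k≰leaves = ≰⇒> k≰leaves

    count-childless< : (C : Fin n → Bool) → (∀ x → C x ≡ true → Childless x) → count C < k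
    count-childless< C childless = ≤-<-trans (count-mono (λ x Cx → childless⇒leaf (childless x Cx))) leaves<k

    countBelow-childless< : ∀ m (C : ℕ → Bool) (g : ℕ → Fin n) →
      (∀ y → y < m → C y ≡ true → Childless (g y)) →
      (∀ y z → y < m → z < m → C y ≡ true → C z ≡ true → g y ≡ g z → y ≡ z) →
      countBelow m C < k
    countBelow-childless< m C g childless g-inj = ≤-<-trans
      (countBelow-injection _ g (λ y y<m Cy → childless⇒leaf (childless y y<m Cy)) g-inj) leaves<k

module Branching {n} {D : Digraph n} (B : Subdigraph D) (isB : IsOutBranching B) where

  private
    A : Digraph n
    A = arcs B

  spanning : ∀ v → verts B v ≡ true
  spanning = proj₂ isB

  isRoot : Fin n → Bool
  isRoot v = verts B v ∧ (inDeg A v ≡ᵇ 0)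

  count-isRoot : count isRoot ≡ 1
  count-isRoot = proj₂ (proj₁ isB)

  private
    root-witness : Σ (Fin n) (λ v → isRoot v ≡ true)
    root-witness = count>0⇒∃ isRoot (≤-reflexive (sym count-isRoot))

  opaque
    root : Fin n
    root = proj₁ root-witness

    root-isRoot : isRoot root ≡ true
    root-isRoot = proj₂ root-witness

  inDeg-root : inDeg A root ≡ 0
  inDeg-root = ≡ᵇ0⇒≡0 (inDeg A root) (∧-conicalʳ (verts B root) _ root-isRoot)
    where
    ≡ᵇ0⇒≡0 : ∀ m → (m ≡ᵇ 0) ≡ true → m ≡ 0
    ≡ᵇ0⇒≡0 zero _ = refl

  inDeg>0 : ∀ {v} → v ≢ root → 0 < inDeg A v
  inDeg>0 {v} v≢root with inDeg A v in inDeg≡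
  ... | suc _ = s≤s z≤n
  ... | zero = ⊥-elim (v≢root (count≡1⇒unique isRoot count-isRoot (∧-intro (spanning v) (cong (_≡ᵇ 0) inDeg≡)) root-isRoot))

  -- B has n − 1 arcs and every vertex other than the root has in-degree at least 1.
  inDeg≡1 : ∀ {v} → v ≢ root → inDeg A v ≡ 1
  inDeg≡1 {v} v≢root = begin
    inDeg A v          ≡⟨ ∑-tight nonRoot (inDeg A) nonRoot≤inDeg ∑inDeg≤∑nonRoot v ⟨
    nonRoot v          ≡⟨ cong (λ b → χ (not b)) (dec-false (v ≟ᶠ root) v≢root) ⟩
    1                  ∎
    where
    open ≡-Reasoning
    nonRoot : Fin n → ℕ
    nonRoot v = χ (not (does (v ≟ᶠ root)))
    nonRoot≤inDeg : ∀ v → nonRoot v ≤ inDeg A v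
    nonRoot≤inDeg v with v ≟ᶠ root
    ... | yes _ = z≤n
    ... | no v≢root = inDeg>0 v≢root
    sum-inDeg : suc (sum (inDeg A)) ≡ n
    sum-inDeg = begin
      suc (sum (inDeg A))   ≡⟨ cong suc (numArcs≡∑inDeg A) ⟨
      suc (numArcs A)       ≡⟨ proj₂ (proj₁ (proj₁ isB)) ⟩
      count (verts B)       ≡⟨ count-cong spanning ⟩
      count {n} (λ _ → true) ≡⟨ count-true ⟩
      n                     ∎
    sum-nonRoot : suc (sum nonRoot) ≡ n
    sum-nonRoot = begin
      suc (sum nonRoot)                                       ≡⟨ cong suc (count≡∑χ (λ v → not (does (v ≟ᶠ root)))) ⟨
      χ true + count (λ v → true ∧ not (does (v ≟ᶠ root)))    ≡⟨ count-remove {n} (λ _ → true) root ⟨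
      count {n} (λ _ → true)                                  ≡⟨ count-true ⟩
      n                                                       ∎
    ∑inDeg≤∑nonRoot : sum (inDeg A) ≤ sum nonRoot
    ∑inDeg≤∑nonRoot = ≤-reflexive (suc-injective (trans sum-inDeg (sym sum-nonRoot)))

  opaque
    parent : Fin n → Fin n
    parent v = choose (λ u → A u v) root

    parent-arc : ∀ {v} → v ≢ root → A (parent v) v ≡ true
    parent-arc {v} v≢root =
      choose-true (λ u → A u v) root (proj₂ (count>0⇒∃ (λ u → A u v) (≤-reflexive (sym (inDeg≡1 v≢root)))))

  arc⇒parent : ∀ {u v} → A u v ≡ true → v ≢ root × u ≡ parent v
  arc⇒parent {u} {v} uv = v≢root , count≡1⇒unique (λ u → A u v) (inDeg≡1 v≢root) uv (parent-arc v≢root)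
    where
    v≢root : v ≢ root
    v≢root refl = <-irrefl (sym inDeg-root) (true⇒count>0 (λ u → A u root) uv)

  parent-arcᴰ : ∀ {v} → v ≢ root → D (parent v) v ≡ true
  parent-arcᴰ v≢root = proj₁ (arcs⊆ B _ _ (parent-arc v≢root))

  data AtDepth : Fin n → ℕ → Set where
    root-at-0 : AtDepth root 0
    parent-at : ∀ {v d} → v ≢ root → AtDepth (parent v) d → AtDepth v (suc d)

  AtDepth-unique : ∀ {v d e} → AtDepth v d → AtDepth v e → d ≡ e
  AtDepth-unique root-at-0 root-at-0 = refl
  AtDepth-unique root-at-0 (parent-at root≢root _) = ⊥-elim (root≢root refl)
  AtDepth-unique (parent-at root≢root _) root-at-0 = ⊥-elim (root≢root refl)
  AtDepth-unique (parent-at _ pd) (parent-at _ pe) = cong suc (AtDepth-unique pd pe)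

  AtDepth-along : ∀ {a b} → UWalk A a b → Σ ℕ (AtDepth a) → Σ ℕ (AtDepth b)
  AtDepth-along here at = at
  AtDepth-along (fwd uv walk) (d , at) with arc⇒parent uv
  ... | v≢root , refl = AtDepth-along walk (suc d , parent-at v≢root at)
  AtDepth-along (bwd {u} vu walk) (d , at) with arc⇒parent vu
  ... | u≢root , refl = AtDepth-along walk (parent-of at)
    where
    parent-of : ∀ {d} → AtDepth u d → Σ ℕ (AtDepth (parent u))
    parent-of root-at-0 = ⊥-elim (u≢root refl)
    parent-of (parent-at {d = d} _ at) = d , at

  private
    depth-witness : ∀ x → Σ ℕ (AtDepth x)
    depth-witness x = AtDepth-along (proj₁ (proj₁ (proj₁ isB)) root x (spanning root) (spanning x)) (0 , root-at-0)

  opaque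
    depth : Fin n → ℕ
    depth x = proj₁ (depth-witness x)

    depth-at : ∀ x → AtDepth x (depth x)
    depth-at x = proj₂ (depth-witness x)

  depth-root : depth root ≡ 0
  depth-root = AtDepth-unique (depth-at root) root-at-0

  depth-parent : ∀ {x} → x ≢ root → depth x ≡ suc (depth (parent x))
  depth-parent {x} x≢root = AtDepth-unique (depth-at x) (parent-at x≢root (depth-at (parent x)))

  depth≡0⇒root : ∀ {x} → depth x ≡ 0 → x ≡ root
  depth≡0⇒root {x} depth≡0 = at-0 (subst (AtDepth x) depth≡0 (depth-at x))
    where
    at-0 : AtDepth x 0 → x ≡ root
    at-0 root-at-0 = refl

  depth>0⇒≢root : ∀ {x} → 0 < depth x → x ≢ root
  depth>0⇒≢root depth>0 refl = <-irrefl (sym depth-root) depth>0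

  opaque
    deepest : Fin n
    deepest = argmax depth root (allFin n)

    depth≤depth-deepest : ∀ x → depth x ≤ depth deepest
    depth≤depth-deepest x = All.lookup (f[xs]≤f[argmax] root (allFin n)) (∈-allFin x)

  height : ℕ
  height = depth deepest

  depth≤height : ∀ x → depth x ≤ height
  depth≤height = depth≤depth-deepest

  depth-ancestor : ∀ m x → m ≤ depth x → depth (fold x parent m) + m ≡ depth x
  depth-ancestor zero x _ = +-identityʳ (depth x)
  depth-ancestor (suc m) x 1+m≤depth = begin
    depth (parent (fold x parent m)) + suc m      ≡⟨ +-suc _ m ⟩
    suc (depth (parent (fold x parent m))) + m    ≡⟨ cong (_+ m) (depth-parent ancestor≢root) ⟨
    depth (fold x parent m) + m                   ≡⟨ IH ⟩
    depth x                                       ∎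
    where
    open ≡-Reasoning
    IH : depth (fold x parent m) + m ≡ depth x
    IH = depth-ancestor m x (≤-trans (n≤1+n m) 1+m≤depth)
    ancestor≢root : fold x parent m ≢ root
    ancestor≢root = depth>0⇒≢root (+-cancelʳ-≤ m 1 _ (≤-trans 1+m≤depth (≤-reflexive (sym IH))))

  spine : ℕ → Fin n
  spine i = fold deepest parent (height ∸ i)

  depth-spine : ∀ {i} → i ≤ height → depth (spine i) ≡ i
  depth-spine {i} i≤height = +-cancelʳ-≡ (height ∸ i) (depth (spine i)) i (begin
    depth (spine i) + (height ∸ i) ≡⟨ depth-ancestor (height ∸ i) deepest (m∸n≤m height i) ⟩
    height                         ≡⟨ m+[n∸m]≡n i≤height ⟨
    i + (height ∸ i)               ∎)
    where open ≡-Reasoning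

  parent-spine : ∀ {i} → i < height → parent (spine (suc i)) ≡ spine i
  parent-spine {i} i<height = cong (fold deepest parent) (sym (+-∸-assoc 1 i<height))

  spine-beyond : ∀ {i} → height ≤ i → spine i ≡ deepest
  spine-beyond h≤i = cong (fold deepest parent) (m≤n⇒m∸n≡0 h≤i)

  spine-height : spine height ≡ deepest
  spine-height = spine-beyond ≤-refl

  spine-0 : spine 0 ≡ root
  spine-0 = depth≡0⇒root (depth-spine z≤n)

  spine-injective : ∀ {i j} → i ≤ height → j ≤ height → spine i ≡ spine j → i ≡ j
  spine-injective i≤h j≤h e = trans (sym (depth-spine i≤h)) (trans (cong depth e) (depth-spine j≤h))

  spine≢root : ∀ {i} → 0 < i → i ≤ height → spine i ≢ root
  spine≢root 0<i i≤h = depth>0⇒≢root (≤-trans 0<i (≤-reflexive (sym (depth-spine i≤h))))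

  opaque
    onSpine : Fin n → Bool
    onSpine x = does (spine (depth x) ≟ᶠ x)

    onSpine-spine : ∀ {i} → i ≤ height → onSpine (spine i) ≡ true
    onSpine-spine {i} i≤h = dec-true (spine (depth (spine i)) ≟ᶠ spine i) (cong spine (depth-spine i≤h))

    onSpine⇒ : ∀ {x} → onSpine x ≡ true → spine (depth x) ≡ x
    onSpine⇒ {x} = dec-true⁻¹ (spine (depth x) ≟ᶠ x)

  onSpine-root : onSpine root ≡ true
  onSpine-root = subst (λ z → onSpine z ≡ true) spine-0 (onSpine-spine z≤n)

  offSpine⇒≢root : ∀ {x} → onSpine x ≡ false → x ≢ root
  offSpine⇒≢root off refl = not-¬ onSpine-root off

  parent-onSpine : ∀ {x} → onSpine x ≡ true → x ≢ root → parent x ≡ spine (depth (parent x))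
  parent-onSpine {x} on x≢root = begin
    parent x                           ≡⟨ cong parent (onSpine⇒ on) ⟨
    parent (spine (depth x))           ≡⟨ cong (λ i → parent (spine i)) (depth-parent x≢root) ⟩
    parent (spine (suc (depth (parent x)))) ≡⟨ parent-spine (≤-trans (≤-reflexive (sym (depth-parent x≢root))) (depth≤height x)) ⟩
    spine (depth (parent x))           ∎
    where open ≡-Reasoning

  onSpine-parent : ∀ {x} → onSpine x ≡ true → x ≢ root → onSpine (parent x) ≡ true
  onSpine-parent on x≢root =
    subst (λ z → onSpine z ≡ true) (sym (parent-onSpine on x≢root)) (onSpine-spine (depth≤height _))

  spine-child : ∀ {x i} → x ≢ root → onSpine x ≡ true → parent x ≡ spine i → i ≤ height →
    x ≡ spine (suc i) × suc i ≤ height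
  spine-child {x} {i} x≢root on px≡ i≤h = trans (sym (onSpine⇒ on)) (cong spine depth≡) , subst (_≤ height) depth≡ (depth≤height x)
    where
    depth≡ : depth x ≡ suc i
    depth≡ = trans (depth-parent x≢root) (cong suc (trans (cong depth px≡) (depth-spine i≤h)))

  deepest-childless : ∀ {x} → x ≢ root → parent x ≢ deepest
  deepest-childless {x} x≢root px≡deepest = 1+n≰n (begin
    suc height                 ≡⟨ cong (λ z → suc (depth z)) px≡deepest ⟨
    suc (depth (parent x))     ≡⟨ depth-parent x≢root ⟨
    depth x                    ≤⟨ depth≤height x ⟩
    height                     ∎)
    where open ≤-Reasoning

  private
    attachWithin : ℕ → Fin n → ℕ
    attachWithin zero x = 0
    attachWithin (suc fuel) x = if onSpine x then depth x else attachWithin fuel (parent x)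

    parent-deeper : ∀ {x} → onSpine x ≡ false → depth (parent x) < depth x
    parent-deeper off = ≤-reflexive (sym (depth-parent (offSpine⇒≢root off)))

    attachWithin-stable : ∀ f g x → depth x < f → depth x < g → attachWithin f x ≡ attachWithin g x
    attachWithin-stable (suc f) (suc g) x x<f x<g with onSpine x in on
    ... | true = refl
    ... | false = attachWithin-stable f g (parent x)
      (≤-trans (parent-deeper on) (s≤s⁻¹ x<f)) (≤-trans (parent-deeper on) (s≤s⁻¹ x<g))

  opaque
    attach : Fin n → ℕ
    attach x = attachWithin (suc (depth x)) x

    attach-onSpine : ∀ {x} → onSpine x ≡ true → attach x ≡ depth x
    attach-onSpine {x} on = cong (λ b → if b then depth x else attachWithin (depth x) (parent x)) on

    attach-offSpine : ∀ {x} → onSpine x ≡ false → attach x ≡ attach (parent x)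
    attach-offSpine {x} off = trans
      (cong (λ b → if b then depth x else attachWithin (depth x) (parent x)) off)
      (attachWithin-stable (depth x) (suc (depth (parent x))) (parent x) (parent-deeper off) ≤-refl)

  attach-spine : ∀ {i} → i ≤ height → attach (spine i) ≡ i
  attach-spine i≤h = trans (attach-onSpine (onSpine-spine i≤h)) (depth-spine i≤h)

  attach-root : attach root ≡ 0
  attach-root = trans (attach-onSpine onSpine-root) depth-root

  attach≤depth : ∀ x → attach x ≤ depth x
  attach≤depth x = go (suc (depth x)) x ≤-refl
    where
    go : ∀ fuel x → depth x < fuel → attach x ≤ depth x
    go (suc fuel) x x<fuel with onSpine x in on
    ... | true = ≤-reflexive (attach-onSpine {x} on)
    ... | false = begin
      attach x               ≡⟨ attach-offSpine {x} on ⟩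
      attach (parent x)      ≤⟨ go fuel (parent x) (≤-trans (parent-deeper on) (s≤s⁻¹ x<fuel)) ⟩
      depth (parent x)       ≤⟨ <⇒≤ (parent-deeper on) ⟩
      depth x                ∎
      where open ≤-Reasoning

  attach≤height : ∀ x → attach x ≤ height
  attach≤height x = ≤-trans (attach≤depth x) (depth≤height x)

  attach-parent-onSpine : ∀ {x} → onSpine x ≡ true → x ≢ root → suc (attach (parent x)) ≡ attach x
  attach-parent-onSpine {x} on x≢root = begin
    suc (attach (parent x))   ≡⟨ cong suc (attach-onSpine (onSpine-parent on x≢root)) ⟩
    suc (depth (parent x))    ≡⟨ depth-parent x≢root ⟨
    depth x                   ≡⟨ attach-onSpine on ⟨
    attach x                  ∎
    where open ≡-Reasoning

  attach-parent≤ : ∀ {x} → x ≢ root → attach (parent x) ≤ attach x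
  attach-parent≤ {x} x≢root with onSpine x in on
  ... | true = ≤-trans (n≤1+n _) (≤-reflexive (attach-parent-onSpine on x≢root))
  ... | false = ≤-reflexive (sym (attach-offSpine on))

  opaque
    sideChild : ℕ → Fin n → Bool
    sideChild y z = not (onSpine z) ∧ does (parent z ≟ᶠ spine y)

    hasSideChild : ℕ → Bool
    hasSideChild y = does (any? (λ z → sideChild y z Bool.≟ true))

    hasSideChild-intro : ∀ {y z} → onSpine z ≡ false → parent z ≡ spine y → hasSideChild y ≡ true
    hasSideChild-intro {y} {z} off pz≡ = dec-true (any? (λ z → sideChild y z Bool.≟ true))
      (z , ∧-intro (cong not off) (dec-true (parent z ≟ᶠ spine y) pz≡))

    sideChild⇒ : ∀ {y z} → sideChild y z ≡ true → onSpine z ≡ false × parent z ≡ spine y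
    sideChild⇒ {y} {z} side =
      not-injective (∧-conicalˡ (not (onSpine z)) _ side) ,
      dec-true⁻¹ (parent z ≟ᶠ spine y) (∧-conicalʳ (not (onSpine z)) _ side)

    hasSideChild-elim : ∀ {y} → hasSideChild y ≡ true → Σ (Fin n) (λ z → sideChild y z ≡ true)
    hasSideChild-elim {y} = dec-true⁻¹ (any? (λ z → sideChild y z Bool.≟ true))

  hasSideChild-attach : ∀ {x} → onSpine x ≡ false → hasSideChild (attach x) ≡ true
  hasSideChild-attach {x} off = go (suc (depth x)) x ≤-refl off
    where
    go : ∀ fuel x → depth x < fuel → onSpine x ≡ false → hasSideChild (attach x) ≡ true
    go (suc fuel) x x<fuel off with onSpine (parent x) in on
    ... | true = subst (λ i → hasSideChild i ≡ true)
      (sym (trans (attach-offSpine {x} off) (attach-onSpine {parent x} on)))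
      (hasSideChild-intro {depth (parent x)} {x} off (sym (onSpine⇒ {parent x} on)))
    ... | false = subst (λ i → hasSideChild i ≡ true) (sym (attach-offSpine {x} off))
      (go fuel (parent x) (≤-trans (parent-deeper {x} off) (s≤s⁻¹ x<fuel)) on)

  hasSideChild-beyond : ∀ {y} → height ≤ y → hasSideChild y ≡ false
  hasSideChild-beyond {y} h≤y with hasSideChild y in side
  ... | false = refl
  ... | true with hasSideChild-elim {y} side
  ...   | z , side-z with sideChild⇒ {y} {z} side-z
  ...     | off , pz≡ = ⊥-elim (deepest-childless (offSpine⇒≢root {z} off) (trans pz≡ (spine-beyond h≤y)))

  sideChildOf : ℕ → Fin n
  sideChildOf y = choose (sideChild y) root

  sideChildOf-spec : ∀ {y} → hasSideChild y ≡ true → onSpine (sideChildOf y) ≡ false × parent (sideChildOf y) ≡ spine y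
  sideChildOf-spec {y} sided with hasSideChild-elim {y} sided
  ... | z , side-z = sideChild⇒ {y} {sideChildOf y} (choose-true (sideChild y) root side-z)

  onSpine-deepest : onSpine deepest ≡ true
  onSpine-deepest = subst (λ z → onSpine z ≡ true) spine-height (onSpine-spine ≤-refl)

  deepest≢sideChildOf : ∀ {y} → hasSideChild y ≡ true → deepest ≢ sideChildOf y
  deepest≢sideChildOf sided deepest≡ = not-¬ (subst (λ x → onSpine x ≡ true) deepest≡ onSpine-deepest) (proj₁ (sideChildOf-spec sided))

  spineAndSides : ParentMap D
  spineAndSides = record
    { member = λ x → onSpine x ∨ onSpine (parent x)
    ; root = root
    ; parent = parent
    ; rank = depth
    ; root-member = cong (_∨ onSpine (parent root)) onSpine-root
    ; parent-member = parent-member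
    ; parent-arc = λ _ → parent-arcᴰ
    ; parent-rank = λ _ x≢root → ≤-reflexive (sym (depth-parent x≢root))
    }
    where
    parent-member : ∀ {x} → (onSpine x ∨ onSpine (parent x)) ≡ true → x ≢ root →
      (onSpine (parent x) ∨ onSpine (parent (parent x))) ≡ true
    parent-member {x} mx x≢root with onSpine x in on
    ... | true = cong (_∨ onSpine (parent (parent x))) (onSpine-parent {x} on x≢root)
    ... | false = cong (_∨ onSpine (parent (parent x))) mx

  module SpineAndSides = ParentMapTree spineAndSides

  deepest-childlessˢ : SpineAndSides.Childless deepest
  deepest-childlessˢ = cong (_∨ onSpine (parent deepest)) onSpine-deepest , λ z _ z≢root → deepest-childless z≢root

  sideChildOf-childless : ∀ {y} → hasSideChild y ≡ true → y ≤ height → SpineAndSides.Childless (sideChildOf y)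
  sideChildOf-childless {y} sided y≤h = trans (cong (onSpine (sideChildOf y) ∨_) (trans (cong onSpine parent≡) (onSpine-spine y≤h))) (∨-zeroʳ _) , no-child
    where
    off : onSpine (sideChildOf y) ≡ false
    off = proj₁ (sideChildOf-spec sided)
    parent≡ : parent (sideChildOf y) ≡ spine y
    parent≡ = proj₂ (sideChildOf-spec sided)
    no-child : ∀ z → (onSpine z ∨ onSpine (parent z)) ≡ true → z ≢ root → parent z ≢ sideChildOf y
    no-child z mz z≢root pz≡ with onSpine z in on-z
    ... | true = not-¬ (subst (λ x → onSpine x ≡ true) pz≡ (onSpine-parent {z} on-z z≢root)) off
    ... | false = not-¬ (subst (λ x → onSpine x ≡ true) pz≡ mz) off

  module LevelBounds {k : ℕ} (noK : NoOutTreeWithLeaves D k) where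

    count-level< : ∀ j → count (λ x → does (depth x ≟ j)) < k
    count-level< j = count-childless< noK _ level-childless
      where
      upTo-j : ParentMap D
      upTo-j = record
        { member = λ x → does (depth x ≤? j)
        ; root = root
        ; parent = parent
        ; rank = depth
        ; root-member = dec-true (depth root ≤? j) (≤-trans (≤-reflexive depth-root) z≤n)
        ; parent-member = λ {x} x≤j x≢root → dec-true (depth (parent x) ≤? j)
            (≤-trans (n≤1+n _) (≤-trans (≤-reflexive (sym (depth-parent x≢root))) (dec-true⁻¹ (depth x ≤? j) x≤j)))
        ; parent-arc = λ _ → parent-arcᴰ
        ; parent-rank = λ _ x≢root → ≤-reflexive (sym (depth-parent x≢root))
        }
      open ParentMapTree upTo-j
      level-childless : ∀ x → does (depth x ≟ j) ≡ true → Childless x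
      level-childless x at-j = dec-true (depth x ≤? j) (≤-reflexive depth≡j) , no-child
        where
        depth≡j : depth x ≡ j
        depth≡j = dec-true⁻¹ (depth x ≟ j) at-j
        no-child : ∀ y → does (depth y ≤? j) ≡ true → y ≢ root → parent y ≢ x
        no-child y y≤j y≢root refl = 1+n≰n (begin
          suc j                  ≡⟨ cong suc depth≡j ⟨
          suc (depth (parent y)) ≡⟨ depth-parent y≢root ⟨
          depth y                ≤⟨ dec-true⁻¹ (depth y ≤? j) y≤j ⟩
          j                      ∎)
          where open ≤-Reasoning

    count-depth< : ∀ m → count (λ x → does (depth x <? m)) + m ≤ m * k
    count-depth< zero = ≤-reflexive (trans (+-identityʳ _) (count-false (λ x → dec-false (depth x <? 0) λ ())))
    count-depth< (suc m) = begin
      count below-1+m + suc m                      ≤⟨ +-monoˡ-≤ (suc m) (≤-trans (count-mono at-or-below) (count-∨ at-m below-m)) ⟩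
      (count at-m + count below-m) + suc m         ≡⟨ +-suc (count at-m + count below-m) m ⟩
      suc (count at-m + count below-m + m)         ≡⟨ cong suc (+-assoc (count at-m) (count below-m) m) ⟩
      suc (count at-m) + (count below-m + m)       ≤⟨ +-mono-≤ (count-level< m) (count-depth< m) ⟩
      k + m * k                                    ∎
      where
      open ≤-Reasoning
      below-1+m at-m below-m : Fin n → Bool
      below-1+m x = does (depth x <? suc m)
      at-m x = does (depth x ≟ m)
      below-m x = does (depth x <? m)
      at-or-below : ∀ x → below-1+m x ≡ true → (at-m x ∨ below-m x) ≡ true
      at-or-below x x<1+m with m≤n⇒m<n∨m≡n (s≤s⁻¹ (dec-true⁻¹ (depth x <? suc m) x<1+m))
      ... | inj₁ x<m rewrite dec-true (depth x <? m) x<m = ∨-zeroʳ (at-m x)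
      ... | inj₂ x≡m rewrite dec-true (depth x ≟ m) x≡m = refl

    vertex-bound : n + suc height ≤ suc height * k
    vertex-bound = begin
      n + suc height                                     ≡⟨ cong (_+ suc height) (trans (sym count-true) (count-cong all-below)) ⟩
      count (λ x → does (depth x <? suc height)) + suc height ≤⟨ count-depth< (suc height) ⟩
      suc height * k                                     ∎
      where
      open ≤-Reasoning
      all-below : ∀ x → true ≡ does (depth x <? suc height)
      all-below x = sym (dec-true (depth x <? suc height) (s≤s (depth≤height x)))

    countBelow-hasSideChild+2≤k : countBelow height hasSideChild + 2 ≤ k
    countBelow-hasSideChild+2≤k = begin
      countBelow height hasSideChild + 2               ≡⟨ +-comm (countBelow height hasSideChild) 2 ⟩
      suc (suc (countBelow height hasSideChild))       ≡⟨ cong suc (countBelow-∨-last height hasSideChild) ⟨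
      suc (countBelow (suc height) marked)             ≤⟨ SpineAndSides.countBelow-childless< noK (suc height) marked leafAt leafAt-childless leafAt-injective ⟩
      k                                                ∎
      where
      open ≤-Reasoning
      marked : ℕ → Bool
      marked y = hasSideChild y ∨ does (y ≟ height)
      leafAt : ℕ → Fin n
      leafAt y = if does (y ≟ height) then deepest else sideChildOf y
      leafAt-spec : ∀ y → marked y ≡ true →
        (y ≡ height × leafAt y ≡ deepest) ⊎ (hasSideChild y ≡ true × leafAt y ≡ sideChildOf y)
      leafAt-spec y my with y ≟ height
      ... | yes y≡h = inj₁ (y≡h , cong (λ b → if b then deepest else sideChildOf y) (dec-true (y ≟ height) y≡h))
      ... | no y≢h = inj₂ (sided , cong (λ b → if b then deepest else sideChildOf y) (dec-false (y ≟ height) y≢h))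
        where
        sided : hasSideChild y ≡ true
        sided = trans (sym (∨-identityʳ _)) (trans (cong (hasSideChild y ∨_) (sym (dec-false (y ≟ height) y≢h))) my)
      leafAt-childless : ∀ y → y < suc height → marked y ≡ true → SpineAndSides.Childless (leafAt y)
      leafAt-childless y y≤h my with leafAt-spec y my
      ... | inj₁ (_ , leaf≡) = subst SpineAndSides.Childless (sym leaf≡) deepest-childlessˢ
      ... | inj₂ (sided , leaf≡) = subst SpineAndSides.Childless (sym leaf≡) (sideChildOf-childless sided (s≤s⁻¹ y≤h))
      leafAt-injective : ∀ y z → y < suc height → z < suc height → marked y ≡ true → marked z ≡ true →
        leafAt y ≡ leafAt z → y ≡ z
      leafAt-injective y z y≤h z≤h my mz leaf≡ with leafAt-spec y my | leafAt-spec z mz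
      ... | inj₁ (y≡h , _) | inj₁ (z≡h , _) = trans y≡h (sym z≡h)
      ... | inj₁ (_ , ly) | inj₂ (sz , lz) = ⊥-elim (deepest≢sideChildOf sz (trans (sym ly) (trans leaf≡ lz)))
      ... | inj₂ (sy , ly) | inj₁ (_ , lz) = ⊥-elim (deepest≢sideChildOf sy (trans (sym lz) (trans (sym leaf≡) ly)))
      ... | inj₂ (sy , ly) | inj₂ (sz , lz) = spine-injective (s≤s⁻¹ y≤h) (s≤s⁻¹ z≤h)
        (trans (sym (proj₂ (sideChildOf-spec sy))) (trans (cong parent (trans (sym ly) (trans leaf≡ lz))) (proj₂ (sideChildOf-spec sz))))

    countBelow-spine-childless< : (T : ParentMap D) → ∀ m → m ≤ suc height → (C : ℕ → Bool) →
      (∀ y → y < m → C y ≡ true → ParentMapTree.Childless T (spine y)) → countBelow m C < k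
    countBelow-spine-childless< T m m≤1+h C childless = ParentMapTree.countBelow-childless< T noK m C spine childless
      (λ y z y<m z<m _ _ → spine-injective (s≤s⁻¹ (≤-trans y<m m≤1+h)) (s≤s⁻¹ (≤-trans z<m m≤1+h)))

  module InDegreeTwo (oriented : Oriented D) (inDeg≡2 : ∀ v → inDeg D v ≡ 2) where

    spine-arc : ∀ {i} → 0 < i → i ≤ height → D (spine (i ∸ 1)) (spine i) ≡ true
    spine-arc {suc i} _ 1+i≤h = subst (λ x → D x (spine (suc i)) ≡ true) (parent-spine 1+i≤h) (parent-arcᴰ (spine≢root (s≤s z≤n) 1+i≤h))

    isCoParent : ℕ → Fin n → Bool
    isCoParent i x = D x (spine i) ∧ not (does (x ≟ᶠ spine (i ∸ 1)))

    count-isCoParent : ∀ {i} → 0 < i → i ≤ height → count (isCoParent i) ≡ 1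
    count-isCoParent {i} 0<i i≤h = suc-injective (begin
      suc (count (isCoParent i))                       ≡⟨ cong (λ b → χ b + count (isCoParent i)) (spine-arc 0<i i≤h) ⟨
      χ (D (spine (i ∸ 1)) (spine i)) + count (isCoParent i) ≡⟨ count-remove (λ x → D x (spine i)) (spine (i ∸ 1)) ⟨
      inDeg D (spine i)                                ≡⟨ inDeg≡2 (spine i) ⟩
      2                                                ∎)
      where open ≡-Reasoning

    opaque
      coParent : ℕ → Fin n
      coParent i = choose (isCoParent i) root

      isCoParent-coParent : ∀ {i} → 0 < i → i ≤ height → isCoParent i (coParent i) ≡ true
      isCoParent-coParent {i} 0<i i≤h =
        choose-true (isCoParent i) root (proj₂ (count>0⇒∃ (isCoParent i) (≤-reflexive (sym (count-isCoParent 0<i i≤h)))))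

    coParent-arc : ∀ {i} → 0 < i → i ≤ height → D (coParent i) (spine i) ≡ true
    coParent-arc {i} 0<i i≤h = ∧-conicalˡ (D (coParent i) (spine i)) _ (isCoParent-coParent 0<i i≤h)

    coParent≢prev : ∀ {i} → 0 < i → i ≤ height → coParent i ≢ spine (i ∸ 1)
    coParent≢prev {i} 0<i i≤h = dec-false⁻¹ (coParent i ≟ᶠ spine (i ∸ 1))
      (not-injective (∧-conicalʳ (D (coParent i) (spine i)) _ (isCoParent-coParent 0<i i≤h)))

    coParent≢self : ∀ {i} → 0 < i → i ≤ height → coParent i ≢ spine i
    coParent≢self {i} 0<i i≤h co≡ = not-¬ (subst (λ x → D x (spine i) ≡ true) co≡ (coParent-arc 0<i i≤h)) (proj₁ oriented (spine i))

    coParent≢next : ∀ {i} → 0 < i → i < height → coParent i ≢ spine (suc i)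
    coParent≢next {i} 0<i i<h co≡ = not-¬ (subst (λ x → D x (spine i) ≡ true) co≡ (coParent-arc 0<i (<⇒≤ i<h)))
      (proj₂ oriented (spine i) (spine (suc i)) (spine-arc {suc i} (s≤s z≤n) i<h))

    coAttach : ℕ → ℕ
    coAttach i = attach (coParent i)

    coParent-onSpine : ∀ {i} → onSpine (coParent i) ≡ true → coParent i ≡ spine (coAttach i)
    coParent-onSpine on = sym (trans (cong spine (attach-onSpine on)) (onSpine⇒ on))

    forward : ℕ → Bool
    forward i = does (coAttach i <? i)

    backward : ℕ → Bool
    backward i = does (suc (suc i) ≤? coAttach i)

    forward-onSpine : ∀ {i} → 0 < i → i ≤ height → forward i ≡ true → onSpine (coParent i) ≡ true → suc (coAttach i) < i
    forward-onSpine {i} 0<i i≤h forward-i on with m≤n⇒m<n∨m≡n (dec-true⁻¹ (coAttach i <? i) forward-i)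
    ... | inj₁ lt = lt
    ... | inj₂ 1+a≡i = ⊥-elim (coParent≢prev 0<i i≤h (trans (coParent-onSpine on) (cong (λ j → spine (j ∸ 1)) 1+a≡i)))

    sideways : ∀ {i} → 0 < i → i ≤ height → forward i ≡ false → backward i ≡ false →
      hasSideChild (coAttach i) ≡ true × i ≤ coAttach i × coAttach i ≤ suc i
    sideways {i} 0<i i≤h forward-i backward-i = hasSideChild-attach off , i≤a , a≤1+i
      where
      i≤a : i ≤ coAttach i
      i≤a = ≮⇒≥ (dec-false⁻¹ (coAttach i <? i) forward-i)
      a≤1+i : coAttach i ≤ suc i
      a≤1+i = s≤s⁻¹ (≰⇒> (dec-false⁻¹ (suc (suc i) ≤? coAttach i) backward-i))
      off : onSpine (coParent i) ≡ false
      off with onSpine (coParent i) in on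
      ... | false = refl
      ... | true with m≤n⇒m<n∨m≡n a≤1+i
      ...   | inj₂ a≡1+i = ⊥-elim (coParent≢next 0<i (≤-trans (≤-reflexive (sym a≡1+i)) (attach≤height _)) (trans (coParent-onSpine on) (cong spine a≡1+i)))
      ...   | inj₁ a<1+i = ⊥-elim (coParent≢self 0<i i≤h (trans (coParent-onSpine on) (cong spine (≤-antisym (s≤s⁻¹ a<1+i) i≤a))))

    module SpineBounds {k : ℕ} (noK : NoOutTreeWithLeaves D k) where

      open LevelBounds noK

      forwardSlot : ℕ → Bool
      forwardSlot y = does (suc y ≤? height) ∧ forward (suc y) ∧ not (hasSideChild y)

      forwardChord : ℕ → Bool
      forwardChord y = does (suc y ≤? height) ∧ forward (suc y) ∧ onSpine (coParent (suc y))

      forwardChord⇒ : ∀ {y} → forwardChord y ≡ true → suc y ≤ height × forward (suc y) ≡ true × onSpine (coParent (suc y)) ≡ true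
      forwardChord⇒ {y} act with ∧-true⇒ (does (suc y ≤? height)) act
      ... | y<h , rest with ∧-true⇒ (forward (suc y)) rest
      ...   | is-forward , on = dec-true⁻¹ (suc y ≤? height) y<h , is-forward , on

      forwardChord-next< : ∀ {y} → forwardChord y ≡ true → coAttach (suc y) < y
      forwardChord-next< act with forwardChord⇒ act
      ... | y<h , is-forward , on = s≤s⁻¹ (forward-onSpine (s≤s z≤n) y<h is-forward on)

      module ForwardChordColouring = Alternation forwardChord (λ y → coAttach (suc y)) forwardChord-next<

      -- Forward spine vertices are rehung on their co-parents, except on spine co-parents of colour c. A slot y
      -- of colour c then loses its spine child (whose co-parent is off the spine or of the other colour) and
      -- gains no chord child.
      module ForwardTree (c : Bool) where

        open ForwardChordColouring

        rehang : ℕ → Bool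
        rehang i = does (0 <? i) ∧ does (i ≤? height) ∧ forward i ∧ not (onSpine (coParent i) ∧ does (colour (coAttach i) Bool.≟ c))

        rehung : Fin n → Bool
        rehung x = onSpine x ∧ rehang (depth x)

        newParent : Fin n → Fin n
        newParent x = if rehung x then coParent (depth x) else parent x

        record Rehung (x : Fin n) : Set where
          field
            x≡spine : spine (depth x) ≡ x
            0<i : 0 < depth x
            i≤h : depth x ≤ height
            is-forward : forward (depth x) ≡ true
            not-same-colour : (onSpine (coParent (depth x)) ∧ does (colour (coAttach (depth x)) Bool.≟ c)) ≡ false

        rehung⇒ : ∀ {x} → rehung x ≡ true → Rehung x
        rehung⇒ {x} r with ∧-true⇒ (onSpine x) r
        ... | on , rh with ∧-true⇒ (does (0 <? depth x)) rh
        ...   | 0<i , rh′ with ∧-true⇒ (does (depth x ≤? height)) rh′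
        ...     | i≤h , rh″ with ∧-true⇒ (forward (depth x)) rh″
        ...       | is-forward , not-same = record
          { x≡spine = onSpine⇒ on
          ; 0<i = dec-true⁻¹ (0 <? depth x) 0<i
          ; i≤h = dec-true⁻¹ (depth x ≤? height) i≤h
          ; is-forward = is-forward
          ; not-same-colour = not-injective not-same
          }

        rank : Fin n → ℕ
        rank x = attach x * suc height + depth x

        newParent-arc : ∀ {x} → x ≢ root → D (newParent x) x ≡ true
        newParent-arc {x} x≢root with rehung x in r
        ... | true = let open Rehung (rehung⇒ r) in
          subst (λ z → D (coParent (depth x)) z ≡ true) x≡spine (coParent-arc 0<i i≤h)
        ... | false = parent-arcᴰ x≢root

        newParent-rank : ∀ {x} → x ≢ root → rank (newParent x) < rank x
        newParent-rank {x} x≢root with rehung x in r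
        ... | true = let open Rehung (rehung⇒ r) in
          lex-<ˡ (suc height) (begin-strict
            coAttach (depth x)   <⟨ dec-true⁻¹ (coAttach (depth x) <? depth x) is-forward ⟩
            depth x              ≡⟨ attach-onSpine (∧-conicalˡ (onSpine x) _ r) ⟨
            attach x             ∎) (s≤s (depth≤height _))
          where open ≤-Reasoning
        ... | false = lex-<ʳ (suc height) (attach-parent≤ x≢root) (≤-reflexive (sym (depth-parent x≢root)))

        forwardMap : ParentMap D
        forwardMap = record
          { member = λ _ → true
          ; root = root
          ; parent = newParent
          ; rank = rank
          ; root-member = refl
          ; parent-member = λ _ _ → refl
          ; parent-arc = λ _ → newParent-arc
          ; parent-rank = λ _ → newParent-rank
          }

        open ParentMapTree forwardMap using (Childless)

        slot : ℕ → Bool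
        slot y = forwardSlot y ∧ does (colour y Bool.≟ c)

        record Slot (y : ℕ) : Set where
          field
            y<h : suc y ≤ height
            forward-y : forward (suc y) ≡ true
            no-side : hasSideChild y ≡ false
            colour-y : colour y ≡ c

        slot⇒ : ∀ {y} → slot y ≡ true → Slot y
        slot⇒ {y} slot-y with ∧-true⇒ (forwardSlot y) slot-y
        ... | fs , col with ∧-true⇒ (does (suc y ≤? height)) fs
        ...   | y<h , rest with ∧-true⇒ (forward (suc y)) rest
        ...     | forward-y , no-side = record
          { y<h = dec-true⁻¹ (suc y ≤? height) y<h
          ; forward-y = forward-y
          ; no-side = not-injective no-side
          ; colour-y = dec-true⁻¹ (colour y Bool.≟ c) col
          }

        slot-rehang-next : ∀ {y} → Slot y → rehang (suc y) ≡ true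
        slot-rehang-next {y} sl = ∧-intro (dec-true (0 <? suc y) (s≤s z≤n)) (∧-intro (dec-true (suc y ≤? height) y<h)
          (∧-intro forward-y (cong not (other-colour (onSpine (coParent (suc y))) refl))))
          where
          open Slot sl
          other-colour : ∀ b → onSpine (coParent (suc y)) ≡ b → (b ∧ does (colour (coAttach (suc y)) Bool.≟ c)) ≡ false
          other-colour false _ = refl
          other-colour true on = dec-false (colour (coAttach (suc y)) Bool.≟ c) λ same → not-¬ refl (begin
            colour (coAttach (suc y))          ≡⟨ same ⟩
            c                                  ≡⟨ colour-y ⟨
            colour y                           ≡⟨ colour-next {y} (∧-intro (dec-true (suc y ≤? height) y<h) (∧-intro forward-y on)) ⟩
            not (colour (coAttach (suc y)))    ∎)
            where open ≡-Reasoning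

        slot-childless : ∀ y → slot y ≡ true → Childless (spine y)
        slot-childless y slot-y = refl , no-child
          where
          open Slot (slot⇒ slot-y)
          no-child : ∀ x → true ≡ true → x ≢ root → newParent x ≢ spine y
          no-child x _ x≢root np≡ with rehung x in r
          ... | true = not-¬ (cong₂ _∧_ co-onSpine (dec-true (colour (coAttach (depth x)) Bool.≟ c) co-colour)) not-same-colour
            where
            open Rehung (rehung⇒ r)
            co-onSpine : onSpine (coParent (depth x)) ≡ true
            co-onSpine = subst (λ z → onSpine z ≡ true) (sym np≡) (onSpine-spine (<⇒≤ y<h))
            co-colour : colour (coAttach (depth x)) ≡ c
            co-colour = trans (cong (λ z → colour (attach z)) np≡) (trans (cong colour (attach-spine (<⇒≤ y<h))) colour-y)
          ... | false with onSpine x in on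
          ...   | false = not-¬ (hasSideChild-intro on np≡) no-side
          ...   | true = not-¬ (subst (λ i → rehang i ≡ true) (sym depth≡) (slot-rehang-next (slot⇒ slot-y))) r
            where
            depth≡ : depth x ≡ suc y
            depth≡ = trans (cong depth (proj₁ (spine-child x≢root on np≡ (<⇒≤ y<h)))) (depth-spine y<h)

        height-childless : Childless (spine height)
        height-childless = refl , no-child
          where
          no-child : ∀ x → true ≡ true → x ≢ root → newParent x ≢ spine height
          no-child x _ x≢root np≡ with rehung x in r
          ... | true = <-irrefl a≡h (≤-trans (dec-true⁻¹ (coAttach (depth x) <? depth x) is-forward) i≤h)
            where
            open Rehung (rehung⇒ r)
            a≡h : coAttach (depth x) ≡ height
            a≡h = trans (cong attach np≡) (attach-spine ≤-refl)
          ... | false = deepest-childless x≢root (trans np≡ spine-height)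

        countBelow-slot+2≤k : countBelow height slot + 2 ≤ k
        countBelow-slot+2≤k = begin
          countBelow height slot + 2                                     ≡⟨ +-comm (countBelow height slot) 2 ⟩
          suc (suc (countBelow height slot))                             ≡⟨ cong suc (countBelow-∨-last height slot) ⟨
          suc (countBelow (suc height) (λ y → slot y ∨ does (y ≟ height))) ≤⟨ countBelow-spine-childless< forwardMap (suc height) ≤-refl _ childless ⟩
          k                                                              ∎
          where
          open ≤-Reasoning
          childless : ∀ y → y < suc height → (slot y ∨ does (y ≟ height)) ≡ true → Childless (spine y)
          childless y _ marked with slot y in slot-y
          ... | true = slot-childless y slot-y
          ... | false = subst (λ z → Childless (spine z)) (sym (dec-true⁻¹ (y ≟ height) marked)) height-childless

      countBelow-forwardSlot+4≤2k : countBelow height forwardSlot + 4 ≤ k + k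
      countBelow-forwardSlot+4≤2k = begin
        countBelow height forwardSlot + 4
          ≤⟨ +-monoˡ-≤ 4 (≤-trans (countBelow-mono either-colour) (countBelow-∨ height (slot true) (slot false))) ⟩
        (countBelow height (slot true) + countBelow height (slot false)) + 4 ≡⟨ +-+-2-2 (countBelow height (slot true)) _ ⟩
        (countBelow height (slot true) + 2) + (countBelow height (slot false) + 2) ≤⟨ +-mono-≤ (countBelow-slot+2≤k true) (countBelow-slot+2≤k false) ⟩
        k + k ∎
        where
        open ≤-Reasoning
        open ForwardTree using (slot; countBelow-slot+2≤k)
        open ForwardChordColouring using (colour)
        either-colour : ∀ y → y < height → forwardSlot y ≡ true → (slot true y ∨ slot false y) ≡ true
        either-colour y _ fs rewrite fs with colour y
        ... | true = refl
        ... | false = refl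
        +-+-2-2 : ∀ a b → (a + b) + 4 ≡ (a + 2) + (b + 2)
        +-+-2-2 a b = solve 2 (λ a b → (a :+ b) :+ con 4 := (a :+ con 2) :+ (b :+ con 2)) refl a b
          where open +-*-Solver

      module SegmentTree (L a : ℕ) (J : ℕ → Bool) (0<L : 0 < L) (L<a : L < a) (a≤h : a ≤ height)
        (J-L : J L ≡ true)
        (J⇒ : ∀ {j} → J j ≡ true → L ≤ j × j < a × suc (suc j) ≤ coAttach j)
        (J-prev : ∀ {i} → L < i → i < a → J i ≡ false → J (i ∸ 1) ≡ true) where

        record SegmentVertex (x : Fin n) : Set where
          field
            x≡spine : spine (depth x) ≡ x
            L≤i : L ≤ depth x
            i<a : depth x < a

        opaque
          inSegment : Fin n → Bool
          inSegment x = onSpine x ∧ does (L ≤? depth x) ∧ does (depth x <? a)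

          inSegment⇒ : ∀ {x} → inSegment x ≡ true → SegmentVertex x
          inSegment⇒ {x} seg with ∧-true⇒ (onSpine x) seg
          ... | on , rest with ∧-true⇒ (does (L ≤? depth x)) rest
          ...   | L≤i , i<a = record
            { x≡spine = onSpine⇒ on
            ; L≤i = dec-true⁻¹ (L ≤? depth x) L≤i
            ; i<a = dec-true⁻¹ (depth x <? a) i<a
            }

          inSegment-spine : ∀ {i} → L ≤ i → i < a → inSegment (spine i) ≡ true
          inSegment-spine {i} L≤i i<a = ∧-intro (onSpine-spine i≤h)
            (∧-intro (dec-true (L ≤? depth (spine i)) (subst (L ≤_) (sym (depth-spine i≤h)) L≤i))
                     (dec-true (depth (spine i) <? a) (subst (_< a) (sym (depth-spine i≤h)) i<a)))
            where
            i≤h : i ≤ height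
            i≤h = ≤-trans (<⇒≤ i<a) a≤h

        hop : ℕ → Fin n
        hop i = if J i then coParent i else spine (i ∸ 1)

        L<¬J : ∀ {i} → L ≤ i → J i ≡ false → L < i
        L<¬J L≤i ¬Ji with m≤n⇒m<n∨m≡n L≤i
        ... | inj₁ L<i = L<i
        ... | inj₂ refl = ⊥-elim (not-¬ J-L ¬Ji)

        hop-arc : ∀ {i} → L ≤ i → i < a → D (hop i) (spine i) ≡ true
        hop-arc {i} L≤i i<a with J i in Ji
        ... | true = coParent-arc (≤-trans 0<L L≤i) (≤-trans (<⇒≤ i<a) a≤h)
        ... | false = spine-arc (≤-trans 0<L L≤i) (≤-trans (<⇒≤ i<a) a≤h)

        L≤attach-hop : ∀ {i} → L ≤ i → i < a → L ≤ attach (hop i)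
        L≤attach-hop {i} L≤i i<a with J i in Ji
        ... | true = ≤-trans L≤i (≤-trans (≤-trans (n≤1+n i) (n≤1+n (suc i))) (proj₂ (proj₂ (J⇒ Ji))))
        ... | false = subst (L ≤_) (sym (attach-spine (≤-trans (m∸n≤m i 1) (≤-trans (<⇒≤ i<a) a≤h))))
          (≤-pred-∸ (L<¬J L≤i Ji))
          where
          ≤-pred-∸ : ∀ {L i} → L < i → L ≤ i ∸ 1
          ≤-pred-∸ {L} {suc i} (s≤s L≤i) = L≤i

        member : Fin n → Bool
        member x = does (L ≤? attach x)

        member⇒≢root : ∀ {x} → member x ≡ true → x ≢ root
        member⇒≢root {x} mx refl = <-irrefl refl (≤-trans 0<L (≤-trans (dec-true⁻¹ (L ≤? attach root) mx) (≤-reflexive attach-root)))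

        beyond-segment : ∀ {x} → member x ≡ true → onSpine x ≡ true → inSegment x ≡ false → x ≢ spine a → a < depth x
        beyond-segment {x} mx on out x≢ρ with <-cmp (depth x) a
        ... | tri< i<a _ _ = ⊥-elim (not-¬ (subst (λ z → inSegment z ≡ true) (onSpine⇒ on) (inSegment-spine L≤i i<a)) out)
          where
          L≤i : L ≤ depth x
          L≤i = subst (L ≤_) (attach-onSpine on) (dec-true⁻¹ (L ≤? attach x) mx)
        ... | tri≈ _ i≡a _ = ⊥-elim (x≢ρ (trans (sym (onSpine⇒ on)) (cong spine i≡a)))
        ... | tri> _ _ a<i = a<i

        newParent : Fin n → Fin n
        newParent x = if inSegment x then hop (depth x) else parent x

        newParent-in : ∀ {x} → inSegment x ≡ true → newParent x ≡ hop (depth x)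
        newParent-in {x} seg = cong (λ b → if b then hop (depth x) else parent x) seg

        newParent-out : ∀ {x} → inSegment x ≡ false → newParent x ≡ parent x
        newParent-out {x} out = cong (λ b → if b then hop (depth x) else parent x) out

        attach-parent-outside : ∀ {x} → member x ≡ true → inSegment x ≡ false → x ≢ spine a →
          (a < attach x × a ≤ attach (parent x)) ⊎ attach (parent x) ≡ attach x
        attach-parent-outside {x} mx out x≢ρ with onSpine x in on
        ... | false = inj₂ (sym (attach-offSpine on))
        ... | true = inj₁ (subst (a <_) (sym (attach-onSpine on)) a<i , s≤s⁻¹ (begin
          suc a                    ≤⟨ a<i ⟩
          depth x                  ≡⟨ attach-onSpine on ⟨
          attach x                 ≡⟨ attach-parent-onSpine on (member⇒≢root mx) ⟨
          suc (attach (parent x))  ∎))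
          where
          open ≤-Reasoning
          a<i : a < depth x
          a<i = beyond-segment mx on out x≢ρ

        newParent-member : ∀ {x} → member x ≡ true → x ≢ spine a → member (newParent x) ≡ true
        newParent-member {x} mx x≢ρ with inSegment x in seg
        ... | true = let open SegmentVertex (inSegment⇒ seg) in dec-true (L ≤? attach (hop (depth x))) (L≤attach-hop L≤i i<a)
        ... | false with attach-parent-outside mx seg x≢ρ
        ...   | inj₁ (_ , a≤) = dec-true (L ≤? attach (parent x)) (≤-trans (<⇒≤ L<a) a≤)
        ...   | inj₂ same = trans (cong (λ t → does (L ≤? t)) same) mx

        newParent-arc : ∀ {x} → member x ≡ true → x ≢ spine a → D (newParent x) x ≡ true
        newParent-arc {x} mx x≢ρ with inSegment x in seg
        ... | true = let open SegmentVertex (inSegment⇒ seg) in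
          subst (λ z → D (hop (depth x)) z ≡ true) x≡spine (hop-arc L≤i i<a)
        ... | false = parent-arcᴰ (member⇒≢root mx)

        -- A chord hop from i lands at index ≥ i + 2 and a step back from i ∉ J lands on i − 1 ∈ J,
        -- so the potential 3 (a − i) + 4 [i ∉ J] decreases along every hop.
        potential : ℕ → ℕ
        potential i = if J i then 3 * (a ∸ i) else 3 * (a ∸ i) + 4

        level : Fin n → ℕ
        level x = if does (attach x <? a) then potential (attach x) else 0

        rank : Fin n → ℕ
        rank x = level x * suc height + depth x

        level-below : ∀ {x} → attach x < a → level x ≡ potential (attach x)
        level-below {x} x<a = cong (λ b → if b then potential (attach x) else 0) (dec-true (attach x <? a) x<a)

        level-beyond : ∀ {x} → a ≤ attach x → level x ≡ 0
        level-beyond {x} a≤x = cong (λ b → if b then potential (attach x) else 0) (dec-false (attach x <? a) (≤⇒≯ a≤x))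

        potential≤ : ∀ i → potential i ≤ 3 * (a ∸ i) + 4
        potential≤ i with J i
        ... | true = m≤m+n (3 * (a ∸ i)) 4
        ... | false = ≤-refl

        level-hop< : ∀ {i} → L ≤ i → i < a → level (hop i) < potential i
        level-hop< {i} L≤i i<a with J i in Ji
        ... | true with a ≤? coAttach i
        ...   | yes a≤b = subst (_< 3 * (a ∸ i)) (sym (level-beyond {coParent i} a≤b))
                (*-monoʳ-< 3 (m<n⇒0<n∸m i<a))
        ...   | no a≰b = begin-strict
                level (coParent i)                ≡⟨ level-below {coParent i} b<a ⟩
                potential (coAttach i)            ≤⟨ potential≤ (coAttach i) ⟩
                3 * (a ∸ coAttach i) + 4          <⟨ potential-drop-chord a i (coAttach i) (proj₂ (proj₂ (J⇒ Ji))) b<a ⟩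
                3 * (a ∸ i)                       ∎
          where
          open ≤-Reasoning
          b<a : coAttach i < a
          b<a = ≰⇒> a≰b
        level-hop< {i} L≤i i<a | false = begin-strict
          level (spine (i ∸ 1))            ≡⟨ level-below {spine (i ∸ 1)} (subst (_< a) (sym attach-prev) (≤-trans (s≤s (m∸n≤m i 1)) i<a)) ⟩
          potential (attach (spine (i ∸ 1))) ≡⟨ cong potential attach-prev ⟩
          potential (i ∸ 1)                ≡⟨ cong (λ b → if b then 3 * (a ∸ (i ∸ 1)) else 3 * (a ∸ (i ∸ 1)) + 4) (J-prev (L<¬J L≤i Ji) i<a Ji) ⟩
          3 * (a ∸ (i ∸ 1))                <⟨ potential-drop-step a i (≤-trans 0<L L≤i) (<⇒≤ i<a) ⟩
          3 * (a ∸ i) + 4                  ∎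
          where
          open ≤-Reasoning
          attach-prev : attach (spine (i ∸ 1)) ≡ i ∸ 1
          attach-prev = attach-spine (≤-trans (m∸n≤m i 1) (≤-trans (<⇒≤ i<a) a≤h))

        newParent-rank : ∀ {x} → member x ≡ true → x ≢ spine a → rank (newParent x) < rank x
        newParent-rank {x} mx x≢ρ with inSegment x in seg
        ... | true = let open SegmentVertex (inSegment⇒ seg) in
          lex-<ˡ (suc height) (begin-strict
            level (hop (depth x))       <⟨ level-hop< L≤i i<a ⟩
            potential (depth x)         ≡⟨ cong potential (attach-onSpine on) ⟨
            potential (attach x)        ≡⟨ level-below {x} (subst (_< a) (sym (attach-onSpine on)) i<a) ⟨
            level x                     ∎) (s≤s (depth≤height _))
          where
          open ≤-Reasoning
          on : onSpine x ≡ true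
          on = subst (λ z → onSpine z ≡ true) (SegmentVertex.x≡spine (inSegment⇒ seg)) (onSpine-spine (depth≤height x))
        ... | false = lex-<ʳ (suc height) (≤-reflexive same-level) (≤-reflexive (sym (depth-parent (member⇒≢root mx))))
          where
          same-level : level (parent x) ≡ level x
          same-level with attach-parent-outside mx seg x≢ρ
          ... | inj₁ (a<x , a≤px) = trans (level-beyond {parent x} a≤px) (sym (level-beyond {x} (<⇒≤ a<x)))
          ... | inj₂ same = cong (λ t → if does (t <? a) then potential t else 0) same

        segmentMap : ParentMap D
        segmentMap = record
          { member = member
          ; root = spine a
          ; parent = newParent
          ; rank = rank
          ; root-member = dec-true (L ≤? attach (spine a)) (subst (L ≤_) (sym (attach-spine a≤h)) (<⇒≤ L<a))
          ; parent-member = newParent-member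
          ; parent-arc = newParent-arc
          ; parent-rank = newParent-rank
          }

        open ParentMapTree segmentMap using (Childless)

        record SegmentLeaf (y : ℕ) : Set where
          field
            L≤y : L ≤ y
            y<a : y < a
            next-hops : J (suc y) ≡ true ⊎ suc y ≡ a
            no-side : hasSideChild y ≡ false
            no-chord : ∀ j → J j ≡ true → coParent j ≢ spine y

        segmentLeaf-no-outer-child : ∀ {y} → SegmentLeaf y → ∀ x → member x ≡ true → x ≢ spine a → inSegment x ≡ false →
          parent x ≢ spine y
        segmentLeaf-no-outer-child {y} leaf x mx x≢ρ out px≡ with onSpine x in on
        ... | false = not-¬ (hasSideChild-intro on px≡) no-side
          where open SegmentLeaf leaf
        ... | true = not-next next-hops
          where
          open SegmentLeaf leaf
          x≡next : x ≡ spine (suc y)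
          x≡next = proj₁ (spine-child (member⇒≢root mx) on px≡ (≤-trans (<⇒≤ y<a) a≤h))
          not-next : ¬ (J (suc y) ≡ true ⊎ suc y ≡ a)
          not-next (inj₁ J-next) = not-¬ (subst (λ z → inSegment z ≡ true) (sym x≡next)
            (inSegment-spine (≤-trans L≤y (n≤1+n y)) (proj₁ (proj₂ (J⇒ J-next))))) out
          not-next (inj₂ 1+y≡a) = x≢ρ (trans x≡next (cong spine 1+y≡a))

        segmentLeaf-no-inner-child : ∀ {y} → SegmentLeaf y → ∀ x → inSegment x ≡ true → hop (depth x) ≢ spine y
        segmentLeaf-no-inner-child {y} leaf x seg hop≡ with J (depth x) in Ji
        ... | true = SegmentLeaf.no-chord leaf (depth x) Ji hop≡
        ... | false = not-next next-hops
          where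
          open SegmentLeaf leaf
          open SegmentVertex (inSegment⇒ seg)
          i≡1+y : depth x ≡ suc y
          i≡1+y = begin
            depth x                 ≡⟨ m∸n+n≡m (≤-trans 0<L L≤i) ⟨
            depth x ∸ 1 + 1         ≡⟨ cong (_+ 1) (spine-injective (≤-trans (m∸n≤m _ 1) (≤-trans (<⇒≤ i<a) a≤h)) (≤-trans (<⇒≤ y<a) a≤h) hop≡) ⟩
            y + 1                   ≡⟨ +-comm y 1 ⟩
            suc y                   ∎
            where open ≡-Reasoning
          not-next : ¬ (J (suc y) ≡ true ⊎ suc y ≡ a)
          not-next (inj₁ J-next) = not-¬ J-next (subst (λ i → J i ≡ false) i≡1+y Ji)
          not-next (inj₂ 1+y≡a) = <-irrefl (trans i≡1+y 1+y≡a) i<a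

        segmentLeaf-childless : ∀ {y} → SegmentLeaf y → Childless (spine y)
        segmentLeaf-childless {y} leaf =
          dec-true (L ≤? attach (spine y)) (subst (L ≤_) (sym (attach-spine (≤-trans (<⇒≤ y<a) a≤h))) L≤y) , no-child
          where
          open SegmentLeaf leaf
          no-child : ∀ x → member x ≡ true → x ≢ spine a → newParent x ≢ spine y
          no-child x mx x≢ρ np≡ = by-segment (inSegment x) refl
            where
            by-segment : ∀ b → inSegment x ≡ b → ⊥
            by-segment false out = segmentLeaf-no-outer-child leaf x mx x≢ρ out (trans (sym (newParent-out out)) np≡)
            by-segment true seg = segmentLeaf-no-inner-child leaf x seg (trans (sym (newParent-in seg)) np≡)

        countBelow-segmentLeaf< : (C : ℕ → Bool) → (∀ y → C y ≡ true → SegmentLeaf y) → countBelow a C < k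
        countBelow-segmentLeaf< C leaf = countBelow-spine-childless< segmentMap a (≤-trans a≤h (n≤1+n height)) C
          (λ y _ Cy → segmentLeaf-childless (leaf y Cy))

      module Run (L R : ℕ) (0<L : 0 < L) (L≤R : L ≤ R) (R<h : R < height)
        (run : ∀ {i} → L ≤ i → i ≤ R → backward i ≡ true × hasSideChild i ≡ false) where

        inRun : ℕ → Bool
        inRun y = does (L ≤? y) ∧ does (y ≤? R)

        inRun⇒ : ∀ {y} → inRun y ≡ true → L ≤ y × y ≤ R
        inRun⇒ {y} r with ∧-true⇒ (does (L ≤? y)) r
        ... | L≤y , y≤R = dec-true⁻¹ (L ≤? y) L≤y , dec-true⁻¹ (y ≤? R) y≤R

        inRun-intro : ∀ {y} → L ≤ y → y ≤ R → inRun y ≡ true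
        inRun-intro {y} L≤y y≤R = ∧-intro (dec-true (L ≤? y) L≤y) (dec-true (y ≤? R) y≤R)

        inRun-next : ∀ {y} → inRun y ≡ true → inRun (suc y) ≡ true ⊎ suc y ≡ suc R
        inRun-next {y} r with inRun⇒ r
        ... | L≤y , y≤R with m≤n⇒m<n∨m≡n y≤R
        ...   | inj₁ y<R = inj₁ (inRun-intro (≤-trans L≤y (n≤1+n y)) y<R)
        ...   | inj₂ y≡R = inj₂ (cong suc y≡R)

        leaps : ∀ {j} → inRun j ≡ true → suc (suc j) ≤ coAttach j
        leaps r = dec-true⁻¹ (suc (suc _) ≤? coAttach _) (proj₁ (run (proj₁ (inRun⇒ r)) (proj₂ (inRun⇒ r))))

        no-side : ∀ {y} → inRun y ≡ true → hasSideChild y ≡ false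
        no-side r = proj₂ (run (proj₁ (inRun⇒ r)) (proj₂ (inRun⇒ r)))

        source : ℕ → ℕ
        source j = depth (coParent j)

        chordFrom : ℕ → ℕ → Bool
        chordFrom y j = inRun j ∧ onSpine (coParent j) ∧ does (source j ≟ y)

        record Chord (y j : ℕ) : Set where
          field
            target-inRun : inRun j ≡ true
            source-onSpine : onSpine (coParent j) ≡ true
            source≡ : source j ≡ y

        chordFrom⇒ : ∀ {y j} → chordFrom y j ≡ true → Chord y j
        chordFrom⇒ {y} {j} c with ∧-true⇒ (inRun j) c
        ... | r , rest with ∧-true⇒ (onSpine (coParent j)) rest
        ...   | on , s = record { target-inRun = r ; source-onSpine = on ; source≡ = dec-true⁻¹ (source j ≟ y) s }

        chordFrom-intro : ∀ {y j} → inRun j ≡ true → coParent j ≡ spine y → y ≤ height → chordFrom y j ≡ true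
        chordFrom-intro {y} {j} r co≡ y≤h = ∧-intro r (∧-intro (subst (λ z → onSpine z ≡ true) (sym co≡) (onSpine-spine y≤h))
          (dec-true (source j ≟ y) (trans (cong depth co≡) (depth-spine y≤h))))

        chord-leaps : ∀ {y j} → chordFrom y j ≡ true → suc (suc j) ≤ y
        chord-leaps c = let open Chord (chordFrom⇒ c) in
          ≤-trans (leaps target-inRun) (≤-reflexive (trans (attach-onSpine source-onSpine) source≡))

        chordCount : ℕ → ℕ
        chordCount y = countBelow (suc R) (chordFrom y)

        oneChord : ℕ → Bool
        oneChord y = does (chordCount y ≟ 1)

        target : ℕ → ℕ
        target y = chooseBelow (suc R) (chordFrom y)

        target-chord : ∀ {y} → oneChord y ≡ true → chordFrom y (target y) ≡ true
        target-chord {y} one with countBelow>0⇒∃ {suc R} {chordFrom y} (≤-reflexive (sym (dec-true⁻¹ (chordCount y ≟ 1) one)))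
        ... | j , j<1+R , c = proj₂ (chooseBelow-spec (suc R) (chordFrom y) j<1+R c)

        target-unique : ∀ {y j} → oneChord y ≡ true → chordFrom y j ≡ true → j ≡ target y
        target-unique {y} {j} one c = countBelow≡1⇒unique {suc R} {chordFrom y} (dec-true⁻¹ (chordCount y ≟ 1) one)
          (chord<1+R c) (chord<1+R (target-chord one)) c (target-chord one)
          where
          chord<1+R : ∀ {j} → chordFrom y j ≡ true → j < suc R
          chord<1+R c = s≤s (proj₂ (inRun⇒ (Chord.target-inRun (chordFrom⇒ c))))

        target-leaps : ∀ {y} → oneChord y ≡ true → suc (suc (target y)) ≤ y
        target-leaps one = chord-leaps (target-chord one)

        module AllChords = SegmentTree L (suc R) inRun 0<L (s≤s L≤R) R<h (inRun-intro ≤-refl L≤R)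
          (λ r → proj₁ (inRun⇒ r) , s≤s (proj₂ (inRun⇒ r)) , leaps r)
          (λ L<i i<1+R ¬r → ⊥-elim (not-¬ (inRun-intro (<⇒≤ L<i) (s≤s⁻¹ i<1+R)) ¬r))

        chordless : ℕ → Bool
        chordless y = inRun y ∧ does (chordCount y ≟ 0)

        countBelow-chordless< : countBelow (suc R) chordless < k
        countBelow-chordless< = AllChords.countBelow-segmentLeaf< chordless leaf
          where
          leaf : ∀ y → chordless y ≡ true → AllChords.SegmentLeaf y
          leaf y cl with ∧-true⇒ (inRun y) cl
          ... | r , none = record
            { L≤y = proj₁ (inRun⇒ r)
            ; y<a = s≤s (proj₂ (inRun⇒ r))
            ; next-hops = inRun-next r
            ; no-side = no-side r
            ; no-chord = λ j rj co≡ → not-¬ (chordFrom-intro rj co≡ y≤h)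
                (countBelow≡0⇒false {suc R} {chordFrom y} (dec-true⁻¹ (chordCount y ≟ 0) none) (s≤s (proj₂ (inRun⇒ rj))))
            }
            where
            y≤h : y ≤ height
            y≤h = ≤-trans (proj₂ (inRun⇒ r)) (<⇒≤ R<h)

        target-1< : ∀ {y} → oneChord y ≡ true → target y ∸ 1 < y
        target-1< one = ≤-trans (s≤s (m∸n≤m _ 1)) (≤-trans (n≤1+n _) (target-leaps one))

        open Alternation oneChord (λ y → target y ∸ 1) target-1<

        -- The chords of
        -- classified sources are left unused: by the parity their targets are never consecutive, and by the
        -- colouring none of them ends just above a classified source.
        module Class (b₁ b₂ : Bool) where

          classified : ℕ → Bool
          classified y = inRun y ∧ oneChord y ∧ not (does (target y ≟ L)) ∧ does (parity (target y) Bool.≟ b₁) ∧ does (colour y Bool.≟ b₂)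

          record Classified (y : ℕ) : Set where
            field
              y-inRun : inRun y ≡ true
              y-one : oneChord y ≡ true
              target≢L : target y ≢ L
              target-parity : parity (target y) ≡ b₁
              y-colour : colour y ≡ b₂

          classified⇒ : ∀ {y} → classified y ≡ true → Classified y
          classified⇒ {y} c with ∧-true⇒ (inRun y) c
          ... | r , c₁ with ∧-true⇒ (oneChord y) c₁
          ...   | one , c₂ with ∧-true⇒ (not (does (target y ≟ L))) c₂
          ...     | ≢L , c₃ with ∧-true⇒ (does (parity (target y) Bool.≟ b₁)) c₃
          ...       | par , col = record
            { y-inRun = r
            ; y-one = one
            ; target≢L = dec-false⁻¹ (target y ≟ L) (not-injective ≢L)
            ; target-parity = dec-true⁻¹ (parity (target y) Bool.≟ b₁) par
            ; y-colour = dec-true⁻¹ (colour y Bool.≟ b₂) col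
            }

          claimed : ℕ → Bool
          claimed i = onSpine (coParent i) ∧ classified (source i)

          claimed-target : ∀ {i} → inRun i ≡ true → claimed i ≡ true → target (source i) ≡ i
          claimed-target {i} r cl with ∧-true⇒ (onSpine (coParent i)) cl
          ... | on , c = sym (target-unique (Classified.y-one (classified⇒ c))
            (∧-intro r (∧-intro on (dec-true (source i ≟ source i) refl))))

          claimed-parity : ∀ {i} → inRun i ≡ true → claimed i ≡ true → parity i ≡ b₁
          claimed-parity {i} r cl = trans (cong parity (sym (claimed-target r cl)))
            (Classified.target-parity (classified⇒ (proj₂ (∧-true⇒ (onSpine (coParent i)) cl))))

          unclaimed : ℕ → Bool
          unclaimed i = inRun i ∧ not (claimed i)

          unclaimed-L : unclaimed L ≡ true
          unclaimed-L = ∧-intro rL (cong not (not-claimed (claimed L) refl))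
            where
            rL : inRun L ≡ true
            rL = inRun-intro ≤-refl L≤R
            not-claimed : ∀ b → claimed L ≡ b → b ≡ false
            not-claimed false _ = refl
            not-claimed true cl = ⊥-elim (Classified.target≢L (classified⇒ (proj₂ (∧-true⇒ (onSpine (coParent L)) cl))) (claimed-target rL cl))

          unclaimed⇒inRun : ∀ {i} → unclaimed i ≡ true → inRun i ≡ true
          unclaimed⇒inRun {i} u = proj₁ (∧-true⇒ (inRun i) u)

          claimed-of-¬unclaimed : ∀ {i} → inRun i ≡ true → unclaimed i ≡ false → claimed i ≡ true
          claimed-of-¬unclaimed {i} r u = not-injective (trans (sym (cong (λ b → b ∧ not (claimed i)) r)) u)

          unclaimed-prev : ∀ {i} → L < i → i < suc R → unclaimed i ≡ false → unclaimed (i ∸ 1) ≡ true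
          unclaimed-prev {suc i} L<1+i 1+i≤R u = ∧-intro r-i (cong not (prev-unclaimed (claimed i) refl))
            where
            r-i : inRun i ≡ true
            r-i = inRun-intro (s≤s⁻¹ L<1+i) (≤-trans (n≤1+n i) (s≤s⁻¹ 1+i≤R))
            r-1+i : inRun (suc i) ≡ true
            r-1+i = inRun-intro (<⇒≤ L<1+i) (s≤s⁻¹ 1+i≤R)
            prev-unclaimed : ∀ b → claimed i ≡ b → b ≡ false
            prev-unclaimed false _ = refl
            prev-unclaimed true cl = ⊥-elim (not-¬ refl
              (trans (claimed-parity r-i cl) (sym (claimed-parity r-1+i (claimed-of-¬unclaimed r-1+i u)))))

          unclaimed-leaps : ∀ {j} → unclaimed j ≡ true → L ≤ j × j < suc R × suc (suc j) ≤ coAttach j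
          unclaimed-leaps u = proj₁ (inRun⇒ (unclaimed⇒inRun u)) , s≤s (proj₂ (inRun⇒ (unclaimed⇒inRun u))) , leaps (unclaimed⇒inRun u)

          module Tree = SegmentTree L (suc R) unclaimed 0<L (s≤s L≤R) R<h unclaimed-L unclaimed-leaps unclaimed-prev

          classified-leaf : ∀ y → classified y ≡ true → Tree.SegmentLeaf y
          classified-leaf y c = record
            { L≤y = proj₁ (inRun⇒ y-inRun)
            ; y<a = s≤s (proj₂ (inRun⇒ y-inRun))
            ; next-hops = next-hops (inRun-next y-inRun)
            ; no-side = no-side y-inRun
            ; no-chord = no-chord
            }
            where
            open Classified (classified⇒ c)
            y≤h : y ≤ height
            y≤h = ≤-trans (proj₂ (inRun⇒ y-inRun)) (<⇒≤ R<h)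
            next-unclaimed : inRun (suc y) ≡ true → ∀ b → claimed (suc y) ≡ b → b ≡ false
            next-unclaimed _ false _ = refl
            next-unclaimed r true cl = ⊥-elim (not-¬ refl (begin
              b₂                                         ≡⟨ Classified.y-colour source-classified ⟨
              colour (source (suc y))                    ≡⟨ colour-next (Classified.y-one source-classified) ⟩
              not (colour (target (source (suc y)) ∸ 1)) ≡⟨ cong (λ t → not (colour (t ∸ 1))) (claimed-target r cl) ⟩
              not (colour y)                             ≡⟨ cong not y-colour ⟩
              not b₂                                     ∎))
              where
              open ≡-Reasoning
              source-classified : Classified (source (suc y))
              source-classified = classified⇒ (proj₂ (∧-true⇒ (onSpine (coParent (suc y))) cl))
            next-hops : inRun (suc y) ≡ true ⊎ suc y ≡ suc R → unclaimed (suc y) ≡ true ⊎ suc y ≡ suc R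
            next-hops (inj₂ last) = inj₂ last
            next-hops (inj₁ r) = inj₁ (∧-intro r (cong not (next-unclaimed r (claimed (suc y)) refl)))
            no-chord : ∀ j → unclaimed j ≡ true → coParent j ≢ spine y
            no-chord j u co≡ = not-¬ (∧-intro on-co (subst (λ z → classified z ≡ true) (sym source≡y) c))
              (not-injective (proj₂ (∧-true⇒ (inRun j) u)))
              where
              on-co : onSpine (coParent j) ≡ true
              on-co = subst (λ z → onSpine z ≡ true) (sym co≡) (onSpine-spine y≤h)
              source≡y : source j ≡ y
              source≡y = trans (cong depth co≡) (depth-spine y≤h)

          countBelow-classified< : countBelow (suc R) classified < k
          countBelow-classified< = Tree.countBelow-segmentLeaf< classified classified-leaf

        private
          total : (ℕ → ℕ) → ℕ
          total f = sum {suc R} (λ i → f (toℕ i))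

          countBelow≡total : ∀ (P : ℕ → Bool) → countBelow (suc R) P ≡ total (λ y → χ (P y))
          countBelow≡total P = count≡∑χ {suc R} (λ i → P (toℕ i))

        runLength : countBelow (suc R) inRun ≡ suc R ∸ L
        runLength = begin
          countBelow (suc R) inRun                     ≡⟨ countBelow-cong at-least-L ⟩
          countBelow (suc R) (λ y → does (L ≤? y))     ≡⟨ cong (λ m → countBelow m (λ y → does (L ≤? y))) (m+[n∸m]≡n L≤1+R) ⟨
          countBelow (L + (suc R ∸ L)) (λ y → does (L ≤? y)) ≡⟨ countBelow-≥ L (suc R ∸ L) ⟩
          suc R ∸ L                                    ∎
          where
          open ≡-Reasoning
          L≤1+R : L ≤ suc R
          L≤1+R = ≤-trans L≤R (n≤1+n R)
          at-least-L : ∀ y → y < suc R → inRun y ≡ does (L ≤? y)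
          at-least-L y y≤R = trans (cong (does (L ≤? y) ∧_) (dec-true (y ≤? R) (s≤s⁻¹ y≤R))) (∧-identityʳ _)

        total-chordCount≤ : total chordCount ≤ countBelow (suc R) inRun
        total-chordCount≤ = begin
          total chordCount                                          ≡⟨ sum-cong-≗ {suc R} (λ i → countBelow≡total (chordFrom (toℕ i))) ⟩
          total (λ y → total (λ j → χ (chordFrom y j)))             ≡⟨ ∑-comm {suc R} {suc R} (λ i i′ → χ (chordFrom (toℕ i) (toℕ i′))) ⟩
          total (λ j → total (λ y → χ (chordFrom y j)))             ≤⟨ ∑-mono-≤ {suc R} (λ i → sources≤1 (toℕ i)) ⟩
          total (λ j → χ (inRun j))                                 ≡⟨ countBelow≡total inRun ⟨
          countBelow (suc R) inRun                                  ∎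
          where
          open ≤-Reasoning
          sources≤1 : ∀ j → total (λ y → χ (chordFrom y j)) ≤ χ (inRun j)
          sources≤1 j = by-inRun (inRun j) refl
            where
            sources : total (λ y → χ (chordFrom y j)) ≡ countBelow (suc R) (λ y → chordFrom y j)
            sources = sym (countBelow≡total (λ y → chordFrom y j))
            by-inRun : ∀ b → inRun j ≡ b → total (λ y → χ (chordFrom y j)) ≤ χ b
            by-inRun false rj = ≤-reflexive (trans sources
              (count-false {suc R} (λ i → cong (λ b → b ∧ onSpine (coParent j) ∧ does (source j ≟ toℕ i)) rj)))
            by-inRun true _ = ≤-trans (≤-reflexive sources) (countBelow-≤1 (suc R) (λ y → chordFrom y j)
              (λ y z _ _ cy cz → trans (sym (Chord.source≡ (chordFrom⇒ cy))) (Chord.source≡ (chordFrom⇒ cz))))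

        singles : ℕ → Bool
        singles y = inRun y ∧ oneChord y

        -- Every position is the target of at most one chord, so the chord counts sum to at most the run length;
        -- hence sources of two or more chords are at most as many as the chordless positions.
        runLength≤ : countBelow (suc R) inRun ≤ countBelow (suc R) chordless + countBelow (suc R) chordless + countBelow (suc R) singles
        runLength≤ = +-cancelˡ-≤ len len _ (begin
          len + len                                                 ≡⟨ cong₂ _+_ (countBelow≡total inRun) (countBelow≡total inRun) ⟩
          total (λ y → χ (inRun y)) + total (λ y → χ (inRun y))     ≡⟨ ∑-distrib-+ {suc R} (λ i → χ (inRun (toℕ i))) (λ i → χ (inRun (toℕ i))) ⟨
          total (λ y → χ (inRun y) + χ (inRun y))                   ≤⟨ ∑-mono-≤ {suc R} (λ i → pointwise (toℕ i)) ⟩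
          total (λ y → chordCount y + (χ (chordless y) + χ (chordless y) + χ (singles y)))
            ≡⟨ ∑-distrib-+ {suc R} (λ i → chordCount (toℕ i)) (λ i → χ (chordless (toℕ i)) + χ (chordless (toℕ i)) + χ (singles (toℕ i))) ⟩
          total chordCount + total (λ y → χ (chordless y) + χ (chordless y) + χ (singles y))
            ≡⟨ cong (total chordCount +_) (trans (∑-distrib-+ {suc R} (λ i → χ (chordless (toℕ i)) + χ (chordless (toℕ i))) (λ i → χ (singles (toℕ i))))
                 (cong₂ _+_ (∑-distrib-+ {suc R} (λ i → χ (chordless (toℕ i))) (λ i → χ (chordless (toℕ i)))) refl)) ⟩
          total chordCount + (total (λ y → χ (chordless y)) + total (λ y → χ (chordless y)) + total (λ y → χ (singles y)))
            ≡⟨ cong (total chordCount +_) (cong₂ _+_ (cong₂ _+_ (countBelow≡total chordless) (countBelow≡total chordless)) (countBelow≡total singles)) ⟨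
          total chordCount + (countBelow (suc R) chordless + countBelow (suc R) chordless + countBelow (suc R) singles)
            ≤⟨ +-monoˡ-≤ _ total-chordCount≤ ⟩
          len + (countBelow (suc R) chordless + countBelow (suc R) chordless + countBelow (suc R) singles) ∎)
          where
          open ≤-Reasoning
          len : ℕ
          len = countBelow (suc R) inRun
          two≤ : ∀ c → 2 ≤ c + (χ (does (c ≟ 0)) + χ (does (c ≟ 0)) + χ (does (c ≟ 1)))
          two≤ zero = ≤-refl
          two≤ (suc zero) = ≤-refl
          two≤ (suc (suc c)) = s≤s (s≤s z≤n)
          pointwise : ∀ y → χ (inRun y) + χ (inRun y) ≤ chordCount y + (χ (chordless y) + χ (chordless y) + χ (singles y))
          pointwise y with inRun y
          ... | false = z≤n
          ... | true = two≤ (chordCount y)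

        startsAtL : ℕ → Bool
        startsAtL y = inRun y ∧ oneChord y ∧ does (target y ≟ L)

        countBelow-startsAtL≤1 : countBelow (suc R) startsAtL ≤ 1
        countBelow-startsAtL≤1 = countBelow-≤1 (suc R) startsAtL (λ y z _ _ sy sz → trans (sym (source-L sy)) (source-L sz))
          where
          source-L : ∀ {y} → startsAtL y ≡ true → source L ≡ y
          source-L {y} s with ∧-true⇒ (inRun y) s
          ... | _ , s′ with ∧-true⇒ (oneChord y) s′
          ...   | one , at-L = Chord.source≡ (chordFrom⇒ (subst (λ j → chordFrom y j ≡ true) (dec-true⁻¹ (target y ≟ L) at-L) (target-chord one)))

        singles-covered : ∀ y → y < suc R → singles y ≡ true →
          (startsAtL y ∨ Class.classified true true y ∨ Class.classified true false y ∨
           Class.classified false true y ∨ Class.classified false false y) ≡ true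
        singles-covered y _ s with ∧-true⇒ (inRun y) s
        ... | r , one rewrite r | one with does (target y ≟ L) | parity (target y) | colour y
        ... | true  | _     | _     = refl
        ... | false | true  | true  = refl
        ... | false | true  | false = refl
        ... | false | false | true  = refl
        ... | false | false | false = refl

        countBelow-singles≤ : countBelow (suc R) singles ≤
          countBelow (suc R) startsAtL + (countBelow (suc R) (Class.classified true true) + (countBelow (suc R) (Class.classified true false) +
            (countBelow (suc R) (Class.classified false true) + countBelow (suc R) (Class.classified false false))))
        countBelow-singles≤ = begin
          countBelow (suc R) singles                                 ≤⟨ countBelow-mono singles-covered ⟩
          countBelow (suc R) (λ y → startsAtL y ∨ C₁ y ∨ C₂ y ∨ C₃ y ∨ C₄ y)
            ≤⟨ countBelow-∨ (suc R) startsAtL (λ y → C₁ y ∨ C₂ y ∨ C₃ y ∨ C₄ y) ⟩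
          #E + countBelow (suc R) (λ y → C₁ y ∨ C₂ y ∨ C₃ y ∨ C₄ y)  ≤⟨ +-monoʳ-≤ #E (countBelow-∨ (suc R) C₁ (λ y → C₂ y ∨ C₃ y ∨ C₄ y)) ⟩
          #E + (#C₁ + countBelow (suc R) (λ y → C₂ y ∨ C₃ y ∨ C₄ y))  ≤⟨ +-monoʳ-≤ #E (+-monoʳ-≤ #C₁ (countBelow-∨ (suc R) C₂ (λ y → C₃ y ∨ C₄ y))) ⟩
          #E + (#C₁ + (#C₂ + countBelow (suc R) (λ y → C₃ y ∨ C₄ y))) ≤⟨ +-monoʳ-≤ #E (+-monoʳ-≤ #C₁ (+-monoʳ-≤ #C₂ (countBelow-∨ (suc R) C₃ C₄))) ⟩
          #E + (#C₁ + (#C₂ + (#C₃ + #C₄)))                           ∎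
          where
          open ≤-Reasoning
          C₁ C₂ C₃ C₄ : ℕ → Bool
          C₁ = Class.classified true true
          C₂ = Class.classified true false
          C₃ = Class.classified false true
          C₄ = Class.classified false false
          #E #C₁ #C₂ #C₃ #C₄ : ℕ
          #E = countBelow (suc R) startsAtL
          #C₁ = countBelow (suc R) C₁
          #C₂ = countBelow (suc R) C₂
          #C₃ = countBelow (suc R) C₃
          #C₄ = countBelow (suc R) C₄

        run-bound : suc R ∸ L + 5 ≤ 6 * k
        run-bound = begin
          suc R ∸ L + 5                                       ≡⟨ cong (_+ 5) runLength ⟨
          countBelow (suc R) inRun + 5                        ≤⟨ +-monoˡ-≤ 5 (≤-trans runLength≤ (+-monoʳ-≤ (Z + Z) countBelow-singles≤)) ⟩
          Z + Z + (E + (C₁ + (C₂ + (C₃ + C₄)))) + 5           ≤⟨ +-monoˡ-≤ 5 (+-monoʳ-≤ (Z + Z) (+-monoˡ-≤ _ countBelow-startsAtL≤1)) ⟩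
          Z + Z + (1 + (C₁ + (C₂ + (C₃ + C₄)))) + 5           ≡⟨ rearrange Z C₁ C₂ C₃ C₄ ⟩
          suc Z + (suc Z + (suc C₁ + (suc C₂ + (suc C₃ + (suc C₄ + 0)))))
            ≤⟨ +-mono-≤ countBelow-chordless< (+-mono-≤ countBelow-chordless< (+-mono-≤ (Class.countBelow-classified< true true)
                 (+-mono-≤ (Class.countBelow-classified< true false) (+-mono-≤ (Class.countBelow-classified< false true)
                   (+-mono-≤ (Class.countBelow-classified< false false) ≤-refl))))) ⟩
          6 * k                                               ∎
          where
          open ≤-Reasoning
          Z E C₁ C₂ C₃ C₄ : ℕ
          Z = countBelow (suc R) chordless
          E = countBelow (suc R) startsAtL
          C₁ = countBelow (suc R) (Class.classified true true)
          C₂ = countBelow (suc R) (Class.classified true false)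
          C₃ = countBelow (suc R) (Class.classified false true)
          C₄ = countBelow (suc R) (Class.classified false false)
          rearrange : ∀ z c₁ c₂ c₃ c₄ → z + z + (1 + (c₁ + (c₂ + (c₃ + c₄)))) + 5 ≡ suc z + (suc z + (suc c₁ + (suc c₂ + (suc c₃ + (suc c₄ + 0)))))
          rearrange = solve 5 (λ z c₁ c₂ c₃ c₄ → z :+ z :+ (con 1 :+ (c₁ :+ (c₂ :+ (c₃ :+ c₄)))) :+ con 5
            := (con 1 :+ z) :+ ((con 1 :+ z) :+ ((con 1 :+ c₁) :+ ((con 1 :+ c₂) :+ ((con 1 :+ c₃) :+ ((con 1 :+ c₄) :+ con 0)))))) refl
            where open +-*-Solver

      bad : ℕ → Bool
      bad y = hasSideChild y ∨ hasSideChild (suc y) ∨ hasSideChild (suc (suc y)) ∨ forwardSlot y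

      record Good (y : ℕ) : Set where
        field
          no-side₀ : hasSideChild y ≡ false
          no-side₁ : hasSideChild (suc y) ≡ false
          no-side₂ : hasSideChild (suc (suc y)) ≡ false
          no-slot : forwardSlot y ≡ false

      good⇒ : ∀ {y} → bad y ≡ false → Good y
      good⇒ {y} good with ∨-false⇒ (hasSideChild y) good
      ... | s₀ , rest with ∨-false⇒ (hasSideChild (suc y)) rest
      ...   | s₁ , rest′ with ∨-false⇒ (hasSideChild (suc (suc y))) rest′
      ...     | s₂ , slot = record { no-side₀ = s₀ ; no-side₁ = s₁ ; no-side₂ = s₂ ; no-slot = slot }

      good⇒¬forward : ∀ {y} → suc y ≤ height → Good y → forward (suc y) ≡ false
      good⇒¬forward {y} 1+y≤h good with forward (suc y) in is-forward
      ... | false = refl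
      ... | true = ⊥-elim (not-¬ (∧-intro (dec-true (suc y ≤? height) 1+y≤h) (∧-intro is-forward (cong not no-side₀))) no-slot)
        where open Good good

      good∧¬backward⇒⊥ : ∀ {y} → suc y ≤ height → Good y → backward (suc y) ≡ false → ⊥
      good∧¬backward⇒⊥ {y} 1+y≤h good not-backward with sideways (s≤s z≤n) 1+y≤h (good⇒¬forward 1+y≤h good) not-backward
      ... | sided , 1+y≤a , a≤2+y with m≤n⇒m<n∨m≡n a≤2+y
      ...   | inj₁ a<2+y = not-¬ (subst (λ i → hasSideChild i ≡ true) (≤-antisym (s≤s⁻¹ a<2+y) 1+y≤a) sided) (Good.no-side₁ good)
      ...   | inj₂ a≡2+y = not-¬ (subst (λ i → hasSideChild i ≡ true) a≡2+y sided) (Good.no-side₂ good)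

      good⇒backward : ∀ {y} → suc (suc y) ≤ height → bad y ≡ false → backward (suc y) ≡ true × hasSideChild (suc y) ≡ false
      good⇒backward {y} 2+y≤h good with backward (suc y) in is-backward
      ... | true = refl , Good.no-side₁ (good⇒ good)
      ... | false = ⊥-elim (good∧¬backward⇒⊥ (≤-trans (n≤1+n _) 2+y≤h) (good⇒ good) is-backward)

      last-bad : ∀ {y} → suc y ≡ height → bad y ≡ true
      last-bad {y} 1+y≡h with bad y in b
      ... | true = refl
      ... | false = ⊥-elim (good∧¬backward⇒⊥ (≤-reflexive 1+y≡h) (good⇒ b)
        (dec-false (suc (suc (suc y)) ≤? coAttach (suc y)) λ 3+y≤a → 1+n≰n (≤-trans (≤-trans (n≤1+n _) 3+y≤a)
          (≤-trans (attach≤height _) (≤-reflexive (sym 1+y≡h))))))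

      trailing : ℕ → ℕ
      trailing zero = 0
      trailing (suc m) = if bad m then 0 else suc (trailing m)

      trailing≤ : ∀ m → trailing m ≤ m
      trailing≤ zero = z≤n
      trailing≤ (suc m) with bad m
      ... | true = z≤n
      ... | false = s≤s (trailing≤ m)

      trailing-good : ∀ m {y} → m ∸ trailing m ≤ y → y < m → bad y ≡ false
      trailing-good (suc m) {y} from y<1+m with bad m in bm
      ... | true = ⊥-elim (<-irrefl refl (≤-trans y<1+m from))
      ... | false with m≤n⇒m<n∨m≡n (s≤s⁻¹ y<1+m)
      ...   | inj₁ y<m = trailing-good m from y<m
      ...   | inj₂ refl = bm

      k≥2 : 2 ≤ k
      k≥2 = ≤-trans (m≤n+m 2 _) countBelow-hasSideChild+2≤k

      trailing+5≤6k : ∀ m → m < height → trailing m + 5 ≤ 6 * k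
      trailing+5≤6k m m<h with trailing m in t
      ... | zero = ≤-trans (n≤1+n 5) (*-monoʳ-≤ 6 (≤-trans (n≤1+n 1) k≥2))
      ... | suc t′ = subst (λ l → l + 5 ≤ 6 * k) (m∸[m∸n]≡n T≤m) (Run.run-bound (suc (m ∸ T)) m (s≤s z≤n) L≤m m<h in-run)
        where
        T : ℕ
        T = suc t′
        T≤m : T ≤ m
        T≤m = subst (_≤ m) t (trailing≤ m)
        L≤m : suc (m ∸ T) ≤ m
        L≤m = ≤-trans (≤-reflexive (sym (+-∸-assoc 1 T≤m))) (∸-monoʳ-≤ {1} {T} (suc m) (s≤s z≤n))
        in-run : ∀ {i} → suc (m ∸ T) ≤ i → i ≤ m → backward i ≡ true × hasSideChild i ≡ false
        in-run {suc y} L≤1+y 1+y≤m = good⇒backward (≤-trans (s≤s 1+y≤m) m<h)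
          (trailing-good m (≤-trans (≤-reflexive (cong (m ∸_) t)) (s≤s⁻¹ L≤1+y)) 1+y≤m)

      trailing-height : trailing height ≡ 0
      trailing-height with height in h
      ... | zero = refl
      ... | suc y rewrite last-bad {y} (sym h) = refl

      -- The positions below m are the bad ones and the maximal good runs, each followed by a bad position.
      prefix-bound : ∀ m → m ≤ height → m + 4 * countBelow m bad ≤ trailing m + 6 * k * countBelow m bad
      prefix-bound zero _ = z≤n
      prefix-bound (suc m) 1+m≤h rewrite countBelow-suc m bad with bad m
      ... | false rewrite +-identityʳ (countBelow m bad) = s≤s (prefix-bound m (≤-trans (n≤1+n m) 1+m≤h))
      ... | true = begin
        suc m + 4 * (b + 1)                 ≡⟨ solve 2 (λ m b → con 1 :+ m :+ con 4 :* (b :+ con 1) := (m :+ con 4 :* b) :+ con 5) refl m b ⟩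
        (m + 4 * b) + 5                     ≤⟨ +-monoˡ-≤ 5 (prefix-bound m (≤-trans (n≤1+n m) 1+m≤h)) ⟩
        (trailing m + 6 * k * b) + 5        ≡⟨ solve 3 (λ t K b → (t :+ K :* b) :+ con 5 := (t :+ con 5) :+ K :* b) refl (trailing m) (6 * k) b ⟩
        (trailing m + 5) + 6 * k * b        ≤⟨ +-monoˡ-≤ (6 * k * b) (trailing+5≤6k m 1+m≤h) ⟩
        6 * k + 6 * k * b                   ≡⟨ solve 2 (λ K b → K :+ K :* b := K :* (b :+ con 1)) refl (6 * k) b ⟩
        6 * k * (b + 1)                     ∎
        where
        open ≤-Reasoning
        open +-*-Solver
        b : ℕ
        b = countBelow m bad

      height-bound : height + 4 * countBelow height bad ≤ 6 * k * countBelow height bad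
      height-bound = subst (λ t → height + 4 * countBelow height bad ≤ t + 6 * k * countBelow height bad)
        trailing-height (prefix-bound height ≤-refl)

      countBelow-bad≤ : countBelow height bad ≤ countBelow height hasSideChild + (countBelow height hasSideChild +
        (countBelow height hasSideChild + countBelow height forwardSlot))
      countBelow-bad≤ = begin
        countBelow height bad
          ≤⟨ countBelow-∨ height hasSideChild (λ y → hasSideChild (suc y) ∨ hasSideChild (suc (suc y)) ∨ forwardSlot y) ⟩
        s + countBelow height (λ y → hasSideChild (suc y) ∨ hasSideChild (suc (suc y)) ∨ forwardSlot y)
          ≤⟨ +-monoʳ-≤ s (countBelow-∨ height (λ y → hasSideChild (suc y)) (λ y → hasSideChild (suc (suc y)) ∨ forwardSlot y)) ⟩
        s + (countBelow height (λ y → hasSideChild (suc y)) + countBelow height (λ y → hasSideChild (suc (suc y)) ∨ forwardSlot y))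
          ≤⟨ +-monoʳ-≤ s (+-mono-≤ shift₁ (countBelow-∨ height (λ y → hasSideChild (suc (suc y))) forwardSlot)) ⟩
        s + (s + (countBelow height (λ y → hasSideChild (suc (suc y))) + countBelow height forwardSlot))
          ≤⟨ +-monoʳ-≤ s (+-monoʳ-≤ s (+-monoˡ-≤ _ shift₂)) ⟩
        s + (s + (s + countBelow height forwardSlot))             ∎
        where
        open ≤-Reasoning
        s : ℕ
        s = countBelow height hasSideChild
        no-side-beyond : ∀ y → height ≤ y → hasSideChild y ≡ false
        no-side-beyond _ = hasSideChild-beyond
        shift₁ : countBelow height (λ y → hasSideChild (suc y)) ≤ s
        shift₁ = ≤-trans (countBelow-shift≤ height hasSideChild) (≤-reflexive (countBelow-false-beyond height 1 hasSideChild no-side-beyond))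
        shift₂ : countBelow height (λ y → hasSideChild (suc (suc y))) ≤ s
        shift₂ = ≤-trans (countBelow-shift≤ height (λ y → hasSideChild (suc y)))
          (≤-trans (countBelow-shift≤ (suc height) hasSideChild) (≤-reflexive (countBelow-false-beyond height 2 hasSideChild no-side-beyond)))

-- With k = j + 2 this gives n ≤ (h + 1)(j + 1) and h ≤ (6 j + 8) · 5 j; the polynomial below is the slack to 2 k⁵.
final-arithmetic : ∀ {n h k s f b} → n + suc h ≤ suc h * k → s + 2 ≤ k → f + 4 ≤ k + k →
  h + 4 * b ≤ 6 * k * b → b ≤ s + (s + (s + f)) → n ≤ 2 * k ^ 5
final-arithmetic {k = zero} {s} _ sides _ _ _ with () ← ≤-trans (m≤n+m 2 s) sides
final-arithmetic {k = suc zero} {s} _ sides _ _ _ with s≤s () ← ≤-trans (m≤n+m 2 s) sides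
final-arithmetic {n} {h} {suc (suc j)} {s} {f} {b} vertices sides forwards height bad = begin
  n                                       ≤⟨ +-cancelʳ-≤ (suc h) n _ (≤-trans vertices (≤-reflexive (solve 2 (λ h j → (con 1 :+ h) :* (con 2 :+ j) := (con 1 :+ h) :* (con 1 :+ j) :+ (con 1 :+ h)) refl h j))) ⟩
  suc h * (1 + j)                         ≤⟨ *-monoˡ-≤ (1 + j) (s≤s (≤-trans h≤ (*-monoʳ-≤ (6 * j + 8) b≤5j))) ⟩
  suc ((6 * j + 8) * (5 * j)) * (1 + j)   ≤⟨ m≤m+n _ (2 * j ^ 5 + 20 * j ^ 4 + 50 * j ^ 3 + 90 * j ^ 2 + 119 * j + 63) ⟩
  suc ((6 * j + 8) * (5 * j)) * (1 + j) + (2 * j ^ 5 + 20 * j ^ 4 + 50 * j ^ 3 + 90 * j ^ 2 + 119 * j + 63)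
    ≡⟨ solve 1 (λ j → (con 1 :+ (con 6 :* j :+ con 8) :* (con 5 :* j)) :* (con 1 :+ j) :+
         (con 2 :* j :^ 5 :+ con 20 :* j :^ 4 :+ con 50 :* j :^ 3 :+ con 90 :* j :^ 2 :+ con 119 :* j :+ con 63)
         := con 2 :* (con 2 :+ j) :^ 5) refl j ⟩
  2 * (2 + j) ^ 5                         ∎
  where
  open ≤-Reasoning
  open +-*-Solver
  s≤j : s ≤ j
  s≤j = s≤s⁻¹ (s≤s⁻¹ (≤-trans (≤-reflexive (+-comm 2 s)) sides))
  f≤2j : f ≤ j + j
  f≤2j = +-cancelʳ-≤ 4 f (j + j) (≤-trans forwards (≤-reflexive (solve 1 (λ j → (con 2 :+ j) :+ (con 2 :+ j) := (j :+ j) :+ con 4) refl j)))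
  b≤5j : b ≤ 5 * j
  b≤5j = ≤-trans bad (≤-trans (+-mono-≤ s≤j (+-mono-≤ s≤j (+-mono-≤ s≤j f≤2j)))
    (≤-reflexive (solve 1 (λ j → j :+ (j :+ (j :+ (j :+ j))) := con 5 :* j) refl j)))
  h≤ : h ≤ (6 * j + 8) * b
  h≤ = +-cancelʳ-≤ (4 * b) h _ (≤-trans height (≤-reflexive (solve 2 (λ j b → con 6 :* (con 2 :+ j) :* b := (con 6 :* j :+ con 8) :* b :+ con 4 :* b) refl j b)))

lemma3p2 : (k n : ℕ) (D : Digraph n) → 1 ≤ k → Oriented D →
    (∀ v → inDeg D v ≡ 2) →
    Σ (Subdigraph D) IsOutBranching →
    ¬ (Σ (Subdigraph D) (λ T → IsOutTree T × k ≤ leaves T)) →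
    n ≤ 2 * k ^ 5
lemma3p2 k n D _ oriented inDeg≡2 (B , isB) noK =
  final-arithmetic vertex-bound countBelow-hasSideChild+2≤k countBelow-forwardSlot+4≤2k height-bound countBelow-bad≤
  where
  open Branching B isB
  open LevelBounds noK
  open InDegreeTwo oriented inDeg≡2
  open SpineBounds noK
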